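{- Let $q$ be a prime power, $n\ge 2$, and let $\sigma:x\mapsto x^{q^m}$ be a non-identity automorphism of $\mathbb{F}_{q^n}$ with $\gcd(m,n)=1$. Let $A$ be a $3\times 3$ matrix over $\mathbb{F}_{q^n}$ and let $\Gamma=\{X\in \mathrm{PG}(2,q^n): X_tAX^\sigma=0\}$ (a $\sigma$-conic, i.e. the set of absolute points of the, possibly degenerate, correlation induced by the $\sigma$-sesquilinear form $\langle x,y\rangle =X_tAY^\sigma$ of $\mathbb{F}_{q^n}^3$). Then every line of $\mathrm{PG}(2,q^n)$ either is contained in $\Gamma$ or meets $\Gamma$ in exactly $0$, $1$, $2$, or $q+1$ points, and in the last case the $q+1$ points form an $\mathbb{F}_q$-subline of that line.
   Context: $X_t$ is the transpose of the coordinate column $X$ and $X^\sigma$ is $\sigma$ applied entrywise. An $\mathbb{F}_q$-subline of a line of $\mathrm{PG}(2,q^n)$ is a set of $q+1$ points of the line which, in suitable homogeneous coordinates on the line, is the set of points with coordinates in $\mathbb{F}_q$. -}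

module Defs where

open import Level using (Level; _⊔_)
open import Algebra.Bundles using (CommutativeRing)
open import Data.Nat as ℕ using (ℕ)
open import Data.Nat.Primality using (Prime)
open import Data.Fin as Fin using (Fin)
open import Data.Product using (Σ; ∃; _×_; _,_)
open import Data.Sum using (_⊎_)
open import Relation.Binary.PropositionalEquality using (_≡_)
open import Relation.Nullary using (¬_)

IsPrimePower : ℕ → Set
IsPrimePower q = Σ ℕ λ p → Σ ℕ λ k → Prime p × (1 ℕ.≤ k) × (q ≡ p ℕ.^ k)

module FieldDefs {c ℓ : Level} (F : CommutativeRing c ℓ) where
  open CommutativeRing F renaming (Carrier to K) hiding (zero)

  IsField : Set (c ⊔ ℓ)
  IsField = (¬ (1# ≈ 0#)) × (∀ x → ¬ (x ≈ 0#) → Σ K λ y → (x * y) ≈ 1#)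

  HasSize : ℕ → Set (c ⊔ ℓ)
  HasSize N = Σ (Fin N → K) λ e →
                (∀ i j → e i ≈ e j → i ≡ j) × (∀ x → Σ (Fin N) λ i → x ≈ e i)

  pow : K → ℕ → K
  pow x ℕ.zero = 1#
  pow x (ℕ.suc k) = x * pow x k

  σ : ℕ → ℕ → K → K
  σ q m x = pow x (q ℕ.^ m)

  NonIdentity : (K → K) → Set (c ⊔ ℓ)
  NonIdentity τ = Σ K λ x → ¬ (τ x ≈ x)

  InFq : ℕ → K → Set ℓ
  InFq q x = pow x q ≈ x

  Vec3 : Set c
  Vec3 = Fin 3 → K

  Mat3 : Set c
  Mat3 = Fin 3 → Fin 3 → K

  sum3 : (Fin 3 → K) → K
  sum3 f = f Fin.zero + (f (Fin.suc Fin.zero) + f (Fin.suc (Fin.suc Fin.zero)))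

  sesq : (K → K) → Mat3 → Vec3 → Vec3 → K
  sesq τ A X Y = sum3 λ i → sum3 λ j → X i * (A i j * τ (Y j))

  NonZero : Vec3 → Set ℓ
  NonZero X = Σ (Fin 3) λ i → ¬ (X i ≈ 0#)

  Proportional : Vec3 → Vec3 → Set (c ⊔ ℓ)
  Proportional X Y = Σ K λ t → ∀ i → X i ≈ (t * Y i)

  -- the point <X> lies on the line with (nonzero) dual coordinates L
  OnLine : Vec3 → Vec3 → Set ℓ
  OnLine L X = sum3 (λ i → L i * X i) ≈ 0#

  InΓ : (K → K) → Mat3 → Vec3 → Set ℓ
  InΓ τ A X = sesq τ A X X ≈ 0#

  LineInΓ : (K → K) → Mat3 → Vec3 → Set (c ⊔ ℓ)
  LineInΓ τ A L = ∀ X → NonZero X → OnLine L X → InΓ τ A X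

  MeetsIn : (K → K) → Mat3 → Vec3 → ℕ → Set (c ⊔ ℓ)
  MeetsIn τ A L k = Σ (Fin k → Vec3) λ P →
      (∀ i → NonZero (P i) × OnLine L (P i) × InΓ τ A (P i))
    × (∀ i j → Proportional (P i) (P j) → i ≡ j)
    × (∀ X → NonZero X → OnLine L X → InΓ τ A X →
         Σ (Fin k) λ i → Proportional X (P i))

  lin : K → Vec3 → K → Vec3 → Vec3
  lin a U b V i = (a * U i) + (b * V i)

  -- the points of Γ on L form an F_q-subline of L: there are homogeneous
  -- coordinates on L (a basis U, V of the underlying 2-space) such that the
  -- points of L ∩ Γ are exactly the points a U + b V with (a,b) ∈ F_q² ∖ {0}
  IsFqSubline : ℕ → (K → K) → Mat3 → Vec3 → Set (c ⊔ ℓ)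
  IsFqSubline q τ A L = Σ Vec3 λ U → Σ Vec3 λ V →
      NonZero U × NonZero V × OnLine L U × OnLine L V
    × (∀ a b → lin a U b V ≈ᵥ zero3 → (a ≈ 0#) × (b ≈ 0#))
    × (∀ X → NonZero X → OnLine L X →
         (InΓ τ A X → Σ K λ a → Σ K λ b → InFq q a × InFq q b
                        × NonZero (lin a U b V) × Proportional X (lin a U b V))
       × ((Σ K λ a → Σ K λ b → InFq q a × InFq q b
                        × NonZero (lin a U b V) × Proportional X (lin a U b V))
          → InΓ τ A X))
    where
      zero3 : Vec3
      zero3 _ = 0#
      _≈ᵥ_ : Vec3 → Vec3 → Set ℓ
      X ≈ᵥ Y = ∀ i → X i ≈ Y i

module Submission where

-- In a basis U, V of the line its points are (a : b) ↦ a U + b V, and Γ is cut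
-- out by G a b = ⟨a U + b V, a U + b V⟩, which satisfies G (s a) (s b) = s σ(s) G a b.
-- With at most two zeros there is nothing to prove. Otherwise rescale three zeros
-- to U, V and U + V; then G a b = γ (b σ(a) - a σ(b)) with γ = ⟨V, U⟩, so either
-- γ = 0 and the line lies in Γ, or the zeros are the points with σ(a/b) = a/b,
-- i.e. (as gcd m n = 1) with coordinates in F_q = {x | x ^ q = x}. That |F_q| = q
-- is counted with the roots of x ^ q - x, an additive map whose image is killed
-- by the trace y + y ^ q + ⋯ + y ^ (q ^ (n - 1)).

open import Algebra.Bundles using (CommutativeRing)
open import Algebra.Morphism.Structures using (module RingMorphisms)
open import Algebra.Solver.Ring.AlmostCommutativeRing
  using (_-Raw-AlmostCommutative⟶_; fromCommutativeRing)
open import Data.Empty using (⊥-elim)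
open import Data.Fin as Fin using (Fin; zero; suc; inject₁; fromℕ)
import Data.Fin.Properties as Fin
open import Data.Fin.Permutation using (Permutation′; permutation)
open import Data.Integer as ℤ using (ℤ; +_; -[1+_]; _⊖_)
import Data.Integer.Properties as ℤ
open import Data.Maybe using (Maybe; just; nothing)
open import Data.Nat as ℕ using (ℕ; zero; suc; _∸_; _<_; _≤_; z≤n; s≤s; _!)
import Data.Nat.Properties as ℕ
open import Data.Nat.Properties using (_!*_!≢0)
open import Data.Nat.Combinatorics using (_C_; nCk≡n!/k![n-k]!; k![n∸k]!∣n!; nCn≡1)
open import Data.Nat.Divisibility using (_∣_; divides; m∣m*n; ∣1⇒≡1; ∣⇒≤)
open import Data.Nat.DivMod using (m/n*n≡m)
open import Data.Nat.GCD using (gcd; gcd-GCD; module Bézout)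
open import Data.Nat.Primality using (Prime; euclidsLemma; ¬prime[0]; ¬prime[1]; prime⇒nonZero; prime⇒nonTrivial)
open import Data.Product using (Σ; ∃; _,_; proj₁; proj₂)
open import Data.Sum using (_⊎_; inj₁; inj₂; map₂)
open import Data.Vec using (Vec; []; _∷_; zipWith; map; replicate; last)
open import Function using (_∘_)
open import Level using (Level; _⊔_)
open import Relation.Nullary using (¬_; Dec; yes; no)
open import Relation.Binary.Definitions using (Decidable)
open import Relation.Binary.PropositionalEquality as ≡ using (_≡_; _≢_)
open import Defs

-- The coefficient morphism ℤ → R for Algebra.Solver.Ring; the library's own
-- instance (NaturalCoefficients) cannot express negation.
module IntegerCoefficients {c ℓ} (R : CommutativeRing c ℓ) where
  open CommutativeRing R
  open import Algebra.Properties.Monoid.Mult +-monoid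
  open import Algebra.Properties.Semiring.Mult semiring using (×1-homo-*)
  open import Algebra.Properties.Ring ring
  open import Relation.Binary.Reasoning.Setoid setoid

  ⟦_⟧ : ℤ → Carrier
  ⟦ + n ⟧ = n × 1#
  ⟦ -[1+ n ] ⟧ = - (suc n × 1#)

  ⟦⊖⟧ : ∀ m n → ⟦ m ⊖ n ⟧ ≈ m × 1# - n × 1#
  ⟦⊖⟧ zero zero = sym (-‿inverseʳ 0#)
  ⟦⊖⟧ zero (suc n) = sym (trans (+-congʳ (×-homo-0 1#)) (+-identityˡ _))
  ⟦⊖⟧ (suc m) zero = sym (trans (+-congˡ (trans (-‿cong (×-homo-0 1#)) -0#≈0#)) (+-identityʳ _))
  ⟦⊖⟧ (suc m) (suc n) = begin
    ⟦ suc m ⊖ suc n ⟧                ≡⟨ ≡.cong ⟦_⟧ (ℤ.[1+m]⊖[1+n]≡m⊖n m n) ⟩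
    ⟦ m ⊖ n ⟧                        ≈⟨ ⟦⊖⟧ m n ⟩
    m × 1# - n × 1#                  ≈⟨ sym (+-identityˡ _) ⟩
    0# + (m × 1# - n × 1#)           ≈⟨ +-congʳ (sym (-‿inverseʳ 1#)) ⟩
    (1# - 1#) + (m × 1# - n × 1#)    ≈⟨ shuffle 1# (m × 1#) (- 1#) (- (n × 1#)) ⟩
    (1# + m × 1#) + (- 1# - n × 1#)  ≈⟨ +-congˡ (-‿+-comm 1# (n × 1#)) ⟩
    (1# + m × 1#) - (1# + n × 1#)    ∎
    where
    shuffle : ∀ a b c d → (a + c) + (b + d) ≈ (a + b) + (c + d)
    shuffle a b c d = begin
      (a + c) + (b + d) ≈⟨ +-assoc a c (b + d) ⟩
      a + (c + (b + d)) ≈⟨ +-congˡ (trans (sym (+-assoc c b d)) (trans (+-congʳ (+-comm c b)) (+-assoc b c d))) ⟩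
      a + (b + (c + d)) ≈⟨ sym (+-assoc a b (c + d)) ⟩
      (a + b) + (c + d) ∎

  ⟦+⟧ : ∀ i j → ⟦ i ℤ.+ j ⟧ ≈ ⟦ i ⟧ + ⟦ j ⟧
  ⟦+⟧ -[1+ m ] -[1+ n ] = begin
    - (suc (suc (m ℕ.+ n)) × 1#)     ≡⟨ ≡.cong (λ k → - (k × 1#)) (≡.sym (ℕ.+-suc (suc m) n)) ⟩
    - ((suc m ℕ.+ suc n) × 1#)       ≈⟨ -‿cong (×-homo-+ 1# (suc m) (suc n)) ⟩
    - (suc m × 1# + suc n × 1#)      ≈⟨ sym (-‿+-comm _ _) ⟩
    - (suc m × 1#) - (suc n × 1#)    ∎
  ⟦+⟧ -[1+ m ] (+ n) = trans (⟦⊖⟧ n (suc m)) (+-comm _ _)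
  ⟦+⟧ (+ m) -[1+ n ] = ⟦⊖⟧ m (suc n)
  ⟦+⟧ (+ m) (+ n) = ×-homo-+ 1# m n

  ⟦-⟧ : ∀ i → ⟦ ℤ.- i ⟧ ≈ - ⟦ i ⟧
  ⟦-⟧ -[1+ n ] = sym (-‿involutive _)
  ⟦-⟧ (+ zero) = sym (trans (-‿cong (×-homo-0 1#)) (trans -0#≈0# (sym (×-homo-0 1#))))
  ⟦-⟧ (+ suc n) = refl

  ⟦*⟧ : ∀ i j → ⟦ i ℤ.* j ⟧ ≈ ⟦ i ⟧ * ⟦ j ⟧
  ⟦*⟧ -[1+ m ] -[1+ n ] = trans (×1-homo-* (suc m) (suc n)) (sym (-‿*-‿ _ _))
    where
    -‿*-‿ : ∀ x y → - x * - y ≈ x * y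
    -‿*-‿ x y = trans (sym (-‿distribˡ-* x (- y))) (trans (-‿cong (sym (-‿distribʳ-* x y))) (-‿involutive _))
  ⟦*⟧ -[1+ m ] (+ zero) rewrite ℕ.*-zeroʳ m = sym (trans (*-congˡ (×-homo-0 1#)) (trans (zeroʳ _) (sym (×-homo-0 1#))))
  ⟦*⟧ -[1+ m ] (+ suc n) = trans (-‿cong (×1-homo-* (suc m) (suc n))) (-‿distribˡ-* _ _)
  ⟦*⟧ (+ zero) -[1+ n ] = sym (trans (*-congʳ (×-homo-0 1#)) (trans (zeroˡ _) (sym (×-homo-0 1#))))
  ⟦*⟧ (+ suc m) -[1+ n ] = trans (-‿cong (×1-homo-* (suc m) (suc n))) (-‿distribʳ-* _ _)
  ⟦*⟧ (+ zero) (+ n) = sym (trans (*-congʳ (×-homo-0 1#)) (trans (zeroˡ _) (sym (×-homo-0 1#))))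
  ⟦*⟧ (+ suc m) (+ zero) rewrite ℕ.*-zeroʳ m = sym (trans (*-congˡ (×-homo-0 1#)) (trans (zeroʳ _) (sym (×-homo-0 1#))))
  ⟦*⟧ (+ suc m) (+ suc n) = ×1-homo-* (suc m) (suc n)

  ℤ⟶R : ℤ.+-*-rawRing -Raw-AlmostCommutative⟶ fromCommutativeRing R
  ℤ⟶R = record
    { ⟦_⟧ = ⟦_⟧ ; +-homo = ⟦+⟧ ; *-homo = ⟦*⟧ ; -‿homo = ⟦-⟧
    ; 0-homo = ×-homo-0 1# ; 1-homo = ×-homo-1 1# }

  _≟ℤ_ : (i j : ℤ) → Maybe (⟦ i ⟧ ≈ ⟦ j ⟧)
  i ≟ℤ j with i ℤ.≟ j
  ... | yes ≡.refl = just refl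
  ... | no _ = nothing

  open import Algebra.Solver.Ring ℤ.+-*-rawRing (fromCommutativeRing R) ℤ⟶R _≟ℤ_ public
    using (Polynomial; solve; _:+_; _:*_; :-_; _:-_; _:=_; con)

  :0 : ∀ {n} → Polynomial n
  :0 = con (+ 0)

record Enumeration {p : Level} {k : ℕ} (P : Fin k → Set p) (t : ℕ) : Set p where
  field
    at : Fin t → Fin k
    at-injective : ∀ a b → at a ≡ at b → a ≡ b
    at-member : ∀ a → P (at a)
    at-complete : ∀ i → P i → Σ (Fin t) λ a → at a ≡ i

  position : ∀ {i} → P i → Fin t
  position {i} pᵢ = proj₁ (at-complete i pᵢ)

  at-position : ∀ {i} (pᵢ : P i) → at (position pᵢ) ≡ i
  at-position {i} pᵢ = proj₂ (at-complete i pᵢ)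

  position-injective : ∀ {i j} (pᵢ : P i) (pⱼ : P j) → position pᵢ ≡ position pⱼ → i ≡ j
  position-injective pᵢ pⱼ eq = ≡.trans (≡.sym (at-position pᵢ)) (≡.trans (≡.cong at eq) (at-position pⱼ))

enumerate : ∀ {p k} {P : Fin k → Set p} → (∀ i → Dec (P i)) → ∃ (Enumeration P)
enumerate {k = zero} P? = 0 , record
  { at = λ () ; at-injective = λ () ; at-member = λ () ; at-complete = λ () }
enumerate {k = suc k} {P} P? with P? zero | enumerate (P? ∘ suc)
... | yes p₀ | t , E = suc t , record
  { at = at′ ; at-injective = injective′ ; at-member = member′ ; at-complete = complete′ }
  where
  open Enumeration E
  at′ : Fin (suc t) → Fin (suc k)
  at′ zero = zero
  at′ (suc a) = suc (at a)
  injective′ : ∀ a b → at′ a ≡ at′ b → a ≡ b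
  injective′ zero zero _ = ≡.refl
  injective′ (suc a) (suc b) eq = ≡.cong suc (at-injective a b (Fin.suc-injective eq))
  member′ : ∀ a → P (at′ a)
  member′ zero = p₀
  member′ (suc a) = at-member a
  complete′ : ∀ i → P i → Σ (Fin (suc t)) λ a → at′ a ≡ i
  complete′ zero _ = zero , ≡.refl
  complete′ (suc i) pi with at-complete i pi
  ... | a , ≡.refl = suc a , ≡.refl
... | no ¬p₀ | t , E = t , record
  { at = suc ∘ at
  ; at-injective = λ a b eq → at-injective a b (Fin.suc-injective eq)
  ; at-member = at-member
  ; at-complete = complete′ }
  where
  open Enumeration E
  complete′ : ∀ i → P i → Σ (Fin t) λ a → suc (at a) ≡ i
  complete′ zero p₀ = ⊥-elim (¬p₀ p₀)
  complete′ (suc i) pi with at-complete i pi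
  ... | a , ≡.refl = a , ≡.refl

prime∤! : ∀ {p} → Prime p → ∀ j → j < p → ¬ (p ∣ j !)
prime∤! pp zero _ p∣1 with ∣1⇒≡1 p∣1
... | ≡.refl = ¬prime[1] pp
prime∤! pp (suc j) j<p p∣j! with euclidsLemma (suc j) (j !) pp p∣j!
... | inj₁ p∣1+j = ℕ.<⇒≱ j<p (∣⇒≤ p∣1+j)
... | inj₂ p∣j! = prime∤! pp j (ℕ.<-trans (ℕ.n<1+n j) j<p) p∣j!

prime∣choose : ∀ {p} → Prime p → ∀ k → 0 < k → k < p → p ∣ p C k
prime∣choose {p} pp k 0<k k<p with euclidsLemma (p C k) (k ! ℕ.* (p ∸ k) !) pp p∣C*k!*[p-k]!
  where
  instance _ = k !* (p ∸ k) !≢0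
  p∣C*k!*[p-k]! : p ∣ (p C k) ℕ.* (k ! ℕ.* (p ∸ k) !)
  p∣C*k!*[p-k]! = ≡.subst (p ∣_) (≡.sym (≡.trans (≡.cong (ℕ._* (k ! ℕ.* (p ∸ k) !)) (nCk≡n!/k![n-k]! (ℕ.<⇒≤ k<p)))
                                                 (m/n*n≡m (k![n∸k]!∣n! (ℕ.<⇒≤ k<p)))))
                                 (n∣n! p (prime⇒nonZero pp))
    where
    n∣n! : ∀ n → ℕ.NonZero n → n ∣ n !
    n∣n! (suc n) _ = m∣m*n (n !)
... | inj₁ p∣C = p∣C
... | inj₂ p∣k!*[p-k]! with euclidsLemma (k !) ((p ∸ k) !) pp p∣k!*[p-k]!
... | inj₁ p∣k! = ⊥-elim (prime∤! pp k k<p p∣k!)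
... | inj₂ p∣[p-k]! = ⊥-elim (prime∤! pp (p ∸ k) (ℕ.∸-monoʳ-< 0<k (ℕ.<⇒≤ k<p)) p∣[p-k]!)

module Frobenius {c ℓ} (R : CommutativeRing c ℓ) where
  open CommutativeRing R hiding (zero)
  open import Algebra.Properties.Semiring.Exp semiring using (_^_; ^-congˡ; ^-assocʳ)
  open import Algebra.Properties.Monoid.Mult +-monoid using (_×_; ×-assocˡ; ×-congʳ; ×-homo-1)
  open import Algebra.Properties.Semiring.Mult semiring using (×-assoc-*)
  open import Algebra.Properties.Monoid.Sum +-monoid using (sum; sum-init-last; sum-cong-≋; sum-replicate-zero)
  open import Algebra.Properties.CommutativeSemiring.Binomial commutativeSemiring
    using (theorem; binomialTerm)
  open import Relation.Binary.Reasoning.Setoid setoid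

  module _ {p : ℕ} (pp : Prime p) (p×1≈0 : p × 1# ≈ 0#) where

    multiple×≈0 : ∀ {n} → p ∣ n → ∀ z → n × z ≈ 0#
    multiple×≈0 (divides d ≡.refl) z = begin
      (d ℕ.* p) × z      ≡⟨ ≡.cong (_× z) (ℕ.*-comm d p) ⟩
      (p ℕ.* d) × z      ≈⟨ ×-assocˡ z p d ⟨
      p × (d × z)        ≈⟨ ×-congʳ p (*-identityˡ _) ⟨
      p × (1# * (d × z)) ≈⟨ ×-assoc-* p 1# _ ⟨
      (p × 1#) * (d × z) ≈⟨ *-congʳ p×1≈0 ⟩
      0# * (d × z)       ≈⟨ zeroˡ _ ⟩
      0#                 ∎

    -- Only the two extreme binomial coefficients of (x + y) ^ p survive.
    ^-prime-additive : ∀ x y → (x + y) ^ p ≈ x ^ p + y ^ p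
    ^-prime-additive x y = via-binomial p ≡.refl
      where
      via-binomial : ∀ p′ → p′ ≡ p → (x + y) ^ p′ ≈ x ^ p′ + y ^ p′
      via-binomial zero ≡.refl = ⊥-elim (¬prime[0] pp)
      via-binomial (suc n) ≡.refl = begin
        (x + y) ^ p                               ≈⟨ theorem p x y ⟩
        t zero + sum (λ i → t (suc i))            ≈⟨ +-congˡ (sum-init-last (λ i → t (suc i))) ⟩
        t zero + (sum (λ i → t (suc (inject₁ i))) + t (suc (fromℕ n)))
                                                  ≈⟨ +-congˡ (+-congʳ (trans (sum-cong-≋ middle-terms) (sum-replicate-zero n))) ⟩
        t zero + (0# + t (suc (fromℕ n)))         ≈⟨ +-cong first-term (trans (+-identityˡ _) last-term) ⟩
        y ^ p + x ^ p                             ≈⟨ +-comm _ _ ⟩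
        x ^ p + y ^ p                             ∎
        where
        t : Fin (suc p) → Carrier
        t = binomialTerm x y p
        first-term : t zero ≈ y ^ p
        first-term = trans (×-homo-1 _) (*-identityˡ _)
        last-term : t (suc (fromℕ n)) ≈ x ^ p
        last-term rewrite Fin.toℕ-fromℕ n | nCn≡1 p | ℕ.n∸n≡0 p = trans (×-homo-1 _) (*-identityʳ _)
        middle-terms : ∀ i → t (suc (inject₁ i)) ≈ 0#
        middle-terms i = multiple×≈0 (prime∣choose pp _ (s≤s z≤n)
          (s≤s (≡.subst (λ m → suc m ≤ n) (≡.sym (Fin.toℕ-inject₁ i)) (Fin.toℕ<n i)))) _

    ^-prime^-additive : ∀ j x y → (x + y) ^ (p ℕ.^ j) ≈ x ^ (p ℕ.^ j) + y ^ (p ℕ.^ j)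
    ^-prime^-additive zero x y = trans (*-identityʳ _) (sym (+-cong (*-identityʳ x) (*-identityʳ y)))
    ^-prime^-additive (suc j) x y = begin
      (x + y) ^ (p ℕ.* p ℕ.^ j)                  ≈⟨ ^-assocʳ (x + y) p (p ℕ.^ j) ⟨
      ((x + y) ^ p) ^ (p ℕ.^ j)                  ≈⟨ ^-congˡ (p ℕ.^ j) (^-prime-additive x y) ⟩
      (x ^ p + y ^ p) ^ (p ℕ.^ j)                ≈⟨ ^-prime^-additive j _ _ ⟩
      (x ^ p) ^ (p ℕ.^ j) + (y ^ p) ^ (p ℕ.^ j)  ≈⟨ +-cong (^-assocʳ x p (p ℕ.^ j)) (^-assocʳ y p (p ℕ.^ j)) ⟩
      x ^ (p ℕ.* p ℕ.^ j) + y ^ (p ℕ.* p ℕ.^ j)  ∎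

module DiscreteField {c ℓ} (F : CommutativeRing c ℓ) (isField : FieldDefs.IsField F)
  (_≟_ : Decidable (CommutativeRing._≈_ F)) where
  open CommutativeRing F renaming (Carrier to K) hiding (zero)
  open FieldDefs F
  open import Algebra.Properties.Semiring.Exp semiring using (_^_)
  open import Relation.Binary.Reasoning.Setoid setoid

  pow≈^ : ∀ x k → pow x k ≈ x ^ k
  pow≈^ x zero = refl
  pow≈^ x (suc k) = *-congˡ (pow≈^ x k)

  1≉0 : 1# ≉ 0#
  1≉0 = proj₁ isField

  _⁻¹⟨_⟩ : (x : K) → x ≉ 0# → K
  x ⁻¹⟨ x≉0 ⟩ = proj₁ (proj₂ isField x x≉0)

  *-inverseʳ : ∀ x (x≉0 : x ≉ 0#) → x * x ⁻¹⟨ x≉0 ⟩ ≈ 1#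
  *-inverseʳ x x≉0 = proj₂ (proj₂ isField x x≉0)

  *-cancelˡ : ∀ {a x y} → a ≉ 0# → a * x ≈ a * y → x ≈ y
  *-cancelˡ {a} {x} {y} a≉0 ax≈ay = begin
    x                       ≈⟨ unit x ⟩
    (a ⁻¹⟨ a≉0 ⟩ * a) * x   ≈⟨ reassoc x ⟩
    a ⁻¹⟨ a≉0 ⟩ * (a * x)   ≈⟨ *-congˡ ax≈ay ⟩
    a ⁻¹⟨ a≉0 ⟩ * (a * y)   ≈⟨ reassoc y ⟨
    (a ⁻¹⟨ a≉0 ⟩ * a) * y   ≈⟨ unit y ⟨
    y                       ∎
    where
    unit : ∀ z → z ≈ (a ⁻¹⟨ a≉0 ⟩ * a) * z
    unit z = sym (trans (*-congʳ (trans (*-comm _ _) (*-inverseʳ a a≉0))) (*-identityˡ z))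
    reassoc : ∀ z → (a ⁻¹⟨ a≉0 ⟩ * a) * z ≈ a ⁻¹⟨ a≉0 ⟩ * (a * z)
    reassoc z = *-assoc _ _ _

  *-nonzero : ∀ {x y} → x ≉ 0# → y ≉ 0# → x * y ≉ 0#
  *-nonzero {x} {y} x≉0 y≉0 xy≈0 = y≉0 (*-cancelˡ x≉0 (trans xy≈0 (sym (zeroʳ x))))

  zero-product : ∀ {x y} → x * y ≈ 0# → x ≈ 0# ⊎ y ≈ 0#
  zero-product {x} {y} xy≈0 with x ≟ 0# | y ≟ 0#
  ... | yes x≈0 | _ = inj₁ x≈0
  ... | no _ | yes y≈0 = inj₂ y≈0
  ... | no x≉0 | no y≉0 = ⊥-elim (*-nonzero x≉0 y≉0 xy≈0)

  *-cancelʳ-zero : ∀ {x y} → y ≉ 0# → x * y ≈ 0# → x ≈ 0#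
  *-cancelʳ-zero y≉0 xy≈0 with zero-product xy≈0
  ... | inj₁ x≈0 = x≈0
  ... | inj₂ y≈0 = ⊥-elim (y≉0 y≈0)

  0#^-nonzero : ∀ k → .{{ℕ.NonZero k}} → 0# ^ k ≈ 0#
  0#^-nonzero (suc k) = zeroˡ _

  1#^ : ∀ k → 1# ^ k ≈ 1#
  1#^ zero = refl
  1#^ (suc k) = trans (*-identityˡ _) (1#^ k)

  *-cancelˡ-zero : ∀ {x y} → x ≉ 0# → x * y ≈ 0# → y ≈ 0#
  *-cancelˡ-zero x≉0 xy≈0 = *-cancelʳ-zero x≉0 (trans (*-comm _ _) xy≈0)

  ^-nonzero : ∀ {x} k → x ≉ 0# → x ^ k ≉ 0#
  ^-nonzero zero _ = 1≉0
  ^-nonzero (suc k) x≉0 = *-nonzero x≉0 (^-nonzero k x≉0)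

  ^≈0⇒≈0 : ∀ {x} k → x ^ k ≈ 0# → x ≈ 0#
  ^≈0⇒≈0 {x} k xᵏ≈0 with x ≟ 0#
  ... | yes x≈0 = x≈0
  ... | no x≉0 = ⊥-elim (^-nonzero k x≉0 xᵏ≈0)

module FiniteField {c ℓ} (F : CommutativeRing c ℓ) (isField : FieldDefs.IsField F)
  {N : ℕ} (size : FieldDefs.HasSize F N) where
  open CommutativeRing F renaming (Carrier to K) hiding (zero)
  open FieldDefs F
  open import Algebra.Properties.Semiring.Exp semiring using (_^_)
  open import Algebra.Properties.Monoid.Mult +-monoid using (_×_)
  import Algebra.Properties.CommutativeMonoid.Sum as Sum
  module Σ+ = Sum +-commutativeMonoid
  module Π* = Sum *-commutativeMonoid
  open import Relation.Binary.Reasoning.Setoid setoid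
  open IntegerCoefficients F using (solve; _:+_; _:-_; _:=_)

  e : Fin N → K
  e = proj₁ size

  e-injective : ∀ i j → e i ≈ e j → i ≡ j
  e-injective = proj₁ (proj₂ size)

  index : K → Fin N
  index x = proj₁ (proj₂ (proj₂ size) x)

  e-index : ∀ x → e (index x) ≈ x
  e-index x = sym (proj₂ (proj₂ (proj₂ size) x))

  index-unique : ∀ x i → e i ≈ x → index x ≡ i
  index-unique x i eᵢ≈x = e-injective _ _ (trans (e-index x) (sym eᵢ≈x))

  _≟_ : Decidable _≈_
  x ≟ y with index x Fin.≟ index y
  ... | yes eq = yes (trans (sym (e-index x)) (trans (reflexive (≡.cong e eq)) (e-index y)))
  ... | no neq = no λ x≈y → neq (≡.sym (index-unique y (index x) (trans (e-index x) x≈y)))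

  open DiscreteField F isField _≟_ public

  enumerated : ∀ {p t} {P : Fin N → Set p} (E : Enumeration P t) {z} → P (index z) →
    Σ (Fin t) λ j → z ≈ e (Enumeration.at E j)
  enumerated E Pz = position Pz , trans (sym (e-index _)) (reflexive (≡.cong e (≡.sym (at-position Pz))))
    where open Enumeration E

  indexPermutation : (f g : K → K) → (∀ {x y} → x ≈ y → f x ≈ f y) → (∀ {x y} → x ≈ y → g x ≈ g y) →
    (∀ x → f (g x) ≈ x) → (∀ x → g (f x) ≈ x) → Permutation′ N
  indexPermutation f g f-cong g-cong fg gf = permutation (λ i → index (f (e i))) (λ i → index (g (e i)))
    (λ i → index-unique _ i (sym (trans (f-cong (e-index _)) (fg (e i)))))
    (λ i → index-unique _ i (sym (trans (g-cong (e-index _)) (gf (e i)))))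

  size×≈0 : ∀ x → N × x ≈ 0#
  size×≈0 x = +-identityʳ-unique (Σ+.sum e) (N × x) (sym (begin
    Σ+.sum e                         ≈⟨ Σ+.sum-permute e (indexPermutation (_+ x) (_- x) +-congʳ +-congʳ
                                          (λ y → solve 2 (λ y x → (y :- x) :+ x := y) refl y x)
                                          (λ y → solve 2 (λ y x → (y :+ x) :- x := y) refl y x)) ⟩
    Σ+.sum (λ i → e (index (e i + x))) ≈⟨ Σ+.sum-cong-≋ (λ i → e-index (e i + x)) ⟩
    Σ+.sum (λ i → e i + x)           ≈⟨ Σ+.∑-distrib-+ e (λ _ → x) ⟩
    Σ+.sum e + Σ+.sum {N} (λ _ → x)  ≈⟨ +-congˡ (Σ+.sum-replicate N) ⟩
    Σ+.sum e + N × x                 ∎))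
    where open import Algebra.Properties.Ring ring using (+-identityʳ-unique)

  nonzeroPart : K → K
  nonzeroPart y with y ≟ 0#
  ... | yes _ = 1#
  ... | no _ = y

  nonzeroPart-nonzero : ∀ y → nonzeroPart y ≉ 0#
  nonzeroPart-nonzero y with y ≟ 0#
  ... | yes _ = 1≉0
  ... | no y≉0 = y≉0

  nonzeroPart-cong : ∀ {y z} → y ≈ z → nonzeroPart y ≈ nonzeroPart z
  nonzeroPart-cong {y} {z} y≈z with y ≟ 0# | z ≟ 0#
  ... | yes _ | yes _ = refl
  ... | yes y≈0 | no z≉0 = ⊥-elim (z≉0 (trans (sym y≈z) y≈0))
  ... | no y≉0 | yes z≈0 = ⊥-elim (y≉0 (trans y≈z z≈0))
  ... | no _ | no _ = y≈z

  ∏-constant-but-one : ∀ {n} x (f : Fin n → K) (i₀ : Fin n) → f i₀ ≈ 1# →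
    (∀ j → j ≢ i₀ → f j ≈ x) → Π*.sum f ≈ x ^ ℕ.pred n
  ∏-constant-but-one {suc n} x f i₀ fi₀≈1 f≈x = begin
    Π*.sum f                                  ≈⟨ Π*.sum-remove f ⟩
    f i₀ * Π*.sum (λ j → f (Fin.punchIn i₀ j)) ≈⟨ *-cong fi₀≈1 (Π*.sum-cong-≋ (λ j → f≈x _ (Fin.punchInᵢ≢i i₀ j))) ⟩
    1# * Π*.sum {n} (λ _ → x)                 ≈⟨ *-identityˡ _ ⟩
    Π*.sum {n} (λ _ → x)                      ≈⟨ Π*.sum-replicate n ⟩
    x ^ n                                     ∎

  ∏-nonzero : ∀ {n} (f : Fin n → K) → (∀ i → f i ≉ 0#) → Π*.sum f ≉ 0#
  ∏-nonzero {zero} f _ = 1≉0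
  ∏-nonzero {suc n} f f≉0 = *-nonzero (f≉0 zero) (∏-nonzero (λ i → f (suc i)) (λ i → f≉0 (suc i)))

  -- Fermat: multiplication by x ≉ 0 permutes K and so fixes the product of
  -- the nonzero parts of all elements, which it multiplies by x ^ (N - 1).
  ^-pred-size : ∀ {x} → x ≉ 0# → x ^ ℕ.pred N ≈ 1#
  ^-pred-size {x} x≉0 = sym (*-cancelˡ (∏-nonzero _ (λ i → nonzeroPart-nonzero (e i))) P*1≈P*xᴺ⁻¹)
    where
    factor : K → K
    factor y with y ≟ 0#
    ... | yes _ = 1#
    ... | no _ = x
    nonzeroPart-* : ∀ y → nonzeroPart (x * y) ≈ factor y * nonzeroPart y
    nonzeroPart-* y with y ≟ 0# | (x * y) ≟ 0#
    ... | yes _ | yes _ = sym (*-identityˡ _)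
    ... | yes y≈0 | no xy≉0 = ⊥-elim (xy≉0 (trans (*-congˡ y≈0) (zeroʳ x)))
    ... | no y≉0 | yes xy≈0 = ⊥-elim (*-nonzero x≉0 y≉0 xy≈0)
    ... | no _ | no _ = refl
    ∏factor : Π*.sum (λ i → factor (e i)) ≈ x ^ ℕ.pred N
    ∏factor = ∏-constant-but-one x _ (index 0#) factor-zero factor-nonzero
      where
      factor-zero : factor (e (index 0#)) ≈ 1#
      factor-zero with e (index 0#) ≟ 0#
      ... | yes _ = refl
      ... | no e≉0 = ⊥-elim (e≉0 (e-index 0#))
      factor-nonzero : ∀ j → j ≢ index 0# → factor (e j) ≈ x
      factor-nonzero j j≢i₀ with e j ≟ 0#
      ... | yes eⱼ≈0 = ⊥-elim (j≢i₀ (≡.sym (index-unique 0# j eⱼ≈0)))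
      ... | no _ = refl
    P = Π*.sum (λ i → nonzeroPart (e i))
    P*1≈P*xᴺ⁻¹ : P * 1# ≈ P * x ^ ℕ.pred N
    P*1≈P*xᴺ⁻¹ = begin
      P * 1#  ≈⟨ *-identityʳ P ⟩
      P       ≈⟨ Π*.sum-permute _ (indexPermutation (x *_) (x ⁻¹⟨ x≉0 ⟩ *_) *-congˡ *-congˡ
                   (λ y → trans (sym (*-assoc _ _ _)) (trans (*-congʳ (*-inverseʳ x x≉0)) (*-identityˡ y)))
                   (λ y → trans (sym (*-assoc _ _ _)) (trans (*-congʳ (trans (*-comm _ _) (*-inverseʳ x x≉0))) (*-identityˡ y)))) ⟩
      Π*.sum (λ i → nonzeroPart (e (index (x * e i)))) ≈⟨ Π*.sum-cong-≋ (λ i → nonzeroPart-cong (e-index (x * e i))) ⟩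
      Π*.sum (λ i → nonzeroPart (x * e i))             ≈⟨ Π*.sum-cong-≋ (λ i → nonzeroPart-* (e i)) ⟩
      Π*.sum (λ i → factor (e i) * nonzeroPart (e i))  ≈⟨ Π*.∑-distrib-+ (λ i → factor (e i)) (λ i → nonzeroPart (e i)) ⟩
      Π*.sum (λ i → factor (e i)) * P                   ≈⟨ *-comm _ _ ⟩
      P * Π*.sum (λ i → factor (e i))                   ≈⟨ *-congˡ ∏factor ⟩
      P * x ^ ℕ.pred N                                  ∎

  ^-size : ∀ x → x ^ N ≈ x
  ^-size x = begin
    x ^ N                    ≡⟨ ≡.cong (x ^_) (≡.sym (ℕ.suc-pred N)) ⟩
    x * x ^ ℕ.pred N         ≈⟨ x*xᴺ⁻¹≈x (x ≟ 0#) ⟩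
    x                        ∎
    where
    instance _ = Fin.nonZeroIndex (index 0#)
    x*xᴺ⁻¹≈x : Dec (x ≈ 0#) → x * x ^ ℕ.pred N ≈ x
    x*xᴺ⁻¹≈x (yes x≈0) = trans (*-congʳ x≈0) (trans (zeroˡ _) (sym x≈0))
    x*xᴺ⁻¹≈x (no x≉0) = trans (*-congˡ (^-pred-size x≉0)) (*-identityʳ x)

  -- An additive map f : K → K has |K| ≤ |ker f| · |im f|: x is recovered from
  -- f x together with x - s (f x), where s is a fixed section of f.
  size≤kernel*image : (f : K → K) → (∀ {x y} → x ≈ y → f x ≈ f y) → (∀ x y → f (x - y) ≈ f x - f y) →
    ∀ {p₁ p₂} {P : Fin N → Set p₁} {Q : Fin N → Set p₂} {a b} → Enumeration P a → Enumeration Q b →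
    (∀ i → f (e i) ≈ 0# → P i) → (∀ x → Q (index (f x))) → N ℕ.≤ a ℕ.* b
  size≤kernel*image f f-cong f-sub {P = P} {Q} {a} {b} EP EQ kernel⊆P image⊆Q =
    Fin.injective⇒≤ {f = encode} (λ {i} {i′} → encode-injective i i′)
    where
    module EP = Enumeration EP
    module EQ = Enumeration EQ
    section : Fin N → K
    section j with Fin.any? (λ i → f (e i) ≟ e j)
    ... | yes (i , _) = e i
    ... | no _ = 0#
    section-correct : ∀ x → f (section (index (f x))) ≈ f x
    section-correct x with Fin.any? (λ i → f (e i) ≟ e (index (f x)))
    ... | yes (i , feᵢ≈y) = trans feᵢ≈y (e-index (f x))
    ... | no none = ⊥-elim (none (index x , trans (f-cong (e-index x)) (sym (e-index (f x)))))
    offset : Fin N → K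
    offset i = e i - section (index (f (e i)))
    offset-kernel : ∀ i → P (index (offset i))
    offset-kernel i = kernel⊆P _ (begin
      f (e (index (offset i)))                                    ≈⟨ f-cong (e-index _) ⟩
      f (e i - section (index (f (e i))))                         ≈⟨ f-sub _ _ ⟩
      f (e i) - f (section (index (f (e i))))                     ≈⟨ +-congˡ (-‿cong (section-correct (e i))) ⟩
      f (e i) - f (e i)                                           ≈⟨ -‿inverseʳ _ ⟩
      0#                                                          ∎)
    encode : Fin N → Fin (a ℕ.* b)
    encode i = Fin.combine (EP.position (offset-kernel i)) (EQ.position (image⊆Q (e i)))
    encode-injective : ∀ i i′ → encode i ≡ encode i′ → i ≡ i′
    encode-injective i i′ eq = e-injective i i′ (begin
      e i                                     ≈⟨ solve 2 (λ x s → x := (x :- s) :+ s) refl (e i) (section (index (f (e i)))) ⟩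
      offset i + section (index (f (e i)))    ≈⟨ +-cong offset≈ (reflexive (≡.cong section image≡)) ⟩
      offset i′ + section (index (f (e i′)))  ≈⟨ solve 2 (λ x s → (x :- s) :+ s := x) refl (e i′) (section (index (f (e i′)))) ⟩
      e i′                                    ∎)
      where
      parts = Fin.combine-injective _ _ _ _ eq
      image≡ : index (f (e i)) ≡ index (f (e i′))
      image≡ = EQ.position-injective (image⊆Q (e i)) (image⊆Q (e i′)) (proj₂ parts)
      offset≈ : offset i ≈ offset i′
      offset≈ = trans (sym (e-index _))
        (trans (reflexive (≡.cong e (EP.position-injective (offset-kernel i) (offset-kernel i′) (proj₁ parts))))
               (e-index _))

module Polynomials {c ℓ} (F : CommutativeRing c ℓ) (isField : FieldDefs.IsField F)
  (_≟_ : Decidable (CommutativeRing._≈_ F)) where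
  open CommutativeRing F renaming (Carrier to K) hiding (zero)
  open import Algebra.Properties.Semiring.Exp semiring using (_^_)
  open import Relation.Binary.Reasoning.Setoid setoid
  open IntegerCoefficients F using (solve; _:+_; _:*_; _:-_; _:=_; :0)
  open DiscreteField F isField _≟_

  -- Coefficient vectors, constant term first.
  eval : ∀ {d} → Vec K d → K → K
  eval [] x = 0#
  eval (c ∷ cs) x = c + x * eval cs x

  eval-cong : ∀ {d} (p : Vec K d) {x y} → x ≈ y → eval p x ≈ eval p y
  eval-cong [] _ = refl
  eval-cong (c ∷ cs) x≈y = +-congˡ (*-cong x≈y (eval-cong cs x≈y))

  eval-zipWith-+ : ∀ {d} (p r : Vec K d) x → eval (zipWith _+_ p r) x ≈ eval p x + eval r x
  eval-zipWith-+ [] [] x = sym (+-identityˡ 0#)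
  eval-zipWith-+ (a ∷ p) (b ∷ r) x = trans (+-congˡ (*-congˡ (eval-zipWith-+ p r x)))
    (solve 5 (λ a b x u v → (a :+ b) :+ x :* (u :+ v) := (a :+ x :* u) :+ (b :+ x :* v)) refl a b x _ _)

  eval-map-* : ∀ {d} a (p : Vec K d) x → eval (map (a *_) p) x ≈ a * eval p x
  eval-map-* a [] x = sym (zeroʳ a)
  eval-map-* a (b ∷ p) x = trans (+-congˡ (*-congˡ (eval-map-* a p x)))
    (solve 4 (λ a b x u → a :* b :+ x :* (a :* u) := a :* (b :+ x :* u)) refl a b x _)

  eval-replicate-0 : ∀ d x → eval (replicate d 0#) x ≈ 0#
  eval-replicate-0 zero x = refl
  eval-replicate-0 (suc d) x = trans (+-congˡ (trans (*-congˡ (eval-replicate-0 d x)) (zeroʳ x))) (+-identityˡ 0#)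

  last-zipWith-+ : ∀ {d} (p r : Vec K (suc d)) → last (zipWith _+_ p r) ≡ last p + last r
  last-zipWith-+ (a ∷ []) (b ∷ []) = ≡.refl
  last-zipWith-+ (a ∷ a′ ∷ p) (b ∷ b′ ∷ r) = last-zipWith-+ (a′ ∷ p) (b′ ∷ r)

  last-map : ∀ {d} (f : K → K) (p : Vec K (suc d)) → last (map f p) ≡ f (last p)
  last-map f (a ∷ []) = ≡.refl
  last-map f (a ∷ a′ ∷ p) = last-map f (a′ ∷ p)

  last-replicate : ∀ d (x : K) → last (replicate (suc d) x) ≡ x
  last-replicate zero x = ≡.refl
  last-replicate (suc d) x = last-replicate d x

  -- Synthetic division by X - a: for p = c + X r, the quotient is r(a) + X (r div (X - a)).
  divLinear : ∀ {d} → K → Vec K (suc d) → Vec K d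
  divLinear a (c ∷ []) = []
  divLinear a (c ∷ cs@(_ ∷ _)) = eval cs a ∷ divLinear a cs

  eval-divLinear : ∀ {d} a (p : Vec K (suc d)) x → eval p x ≈ eval p a + (x - a) * eval (divLinear a p) x
  eval-divLinear a (c ∷ []) x =
    solve 3 (λ c x a → c :+ x :* (:0) := (c :+ a :* (:0)) :+ (x :- a) :* (:0)) refl c x a
  eval-divLinear a (c ∷ cs@(_ ∷ _)) x = begin
    c + x * eval cs x                                  ≈⟨ +-congˡ (*-congˡ (eval-divLinear a cs x)) ⟩
    c + x * (eval cs a + (x - a) * eval (divLinear a cs) x)
      ≈⟨ solve 5 (λ c x a r q → c :+ x :* (r :+ (x :- a) :* q) := (c :+ a :* r) :+ (x :- a) :* (r :+ x :* q))
                 refl c x a (eval cs a) (eval (divLinear a cs) x) ⟩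
    (c + a * eval cs a) + (x - a) * (eval cs a + x * eval (divLinear a cs) x) ∎

  last-divLinear : ∀ {d} a (p : Vec K (suc (suc d))) → last (divLinear a p) ≈ last p
  last-divLinear a (c ∷ c′ ∷ []) = trans (+-congˡ (zeroʳ a)) (+-identityʳ c′)
  last-divLinear a (c ∷ cs@(_ ∷ _ ∷ _)) = last-divLinear a cs

  roots≤degree : ∀ d (p : Vec K (suc d)) → last p ≉ 0# → ∀ {t} (r : Fin t → K) →
    (∀ i j → r i ≈ r j → i ≡ j) → (∀ i → eval p (r i) ≈ 0#) → t ≤ d
  roots≤degree _ _ _ {zero} _ _ _ = z≤n
  roots≤degree zero (c ∷ []) c≉0 {suc t} r _ root =
    ⊥-elim (c≉0 (trans (sym (trans (+-congˡ (zeroʳ _)) (+-identityʳ c))) (root zero)))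
  roots≤degree (suc d) p lead≉0 {suc t} r r-injective root =
    s≤s (roots≤degree d (divLinear a p) (λ q≈0 → lead≉0 (trans (sym (last-divLinear a p)) q≈0))
          (λ i → r (suc i)) (λ i j eq → Fin.suc-injective (r-injective _ _ eq)) quotient-root)
    where
    a = r zero
    quotient-root : ∀ i → eval (divLinear a p) (r (suc i)) ≈ 0#
    quotient-root i = *-cancelˡ-zero rᵢ-a≉0 (begin
      (r (suc i) - a) * eval (divLinear a p) (r (suc i))            ≈⟨ +-identityˡ _ ⟨
      0# + (r (suc i) - a) * eval (divLinear a p) (r (suc i))       ≈⟨ +-congʳ (root zero) ⟨
      eval p a + (r (suc i) - a) * eval (divLinear a p) (r (suc i)) ≈⟨ eval-divLinear a p (r (suc i)) ⟨
      eval p (r (suc i))                                            ≈⟨ root (suc i) ⟩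
      0#                                                            ∎)
      where
      open import Algebra.Properties.Ring ring using (x∙y⁻¹≈ε⇒x≈y)
      rᵢ-a≉0 : r (suc i) - a ≉ 0#
      rᵢ-a≉0 rᵢ-a≈0 = Fin.0≢1+n (r-injective _ _ (sym (x∙y⁻¹≈ε⇒x≈y _ _ rᵢ-a≈0)))

  -- X ^ k padded to formal degree D; junk when k > D.
  monomial : ℕ → (D : ℕ) → Vec K (suc D)
  monomial zero D = 1# ∷ replicate D 0#
  monomial (suc k) zero = 0# ∷ []
  monomial (suc k) (suc D) = 0# ∷ monomial k D

  eval-monomial : ∀ k D → k ≤ D → ∀ x → eval (monomial k D) x ≈ x ^ k
  eval-monomial zero D _ x = trans (+-congˡ (trans (*-congˡ (eval-replicate-0 D x)) (zeroʳ x))) (+-identityʳ 1#)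
  eval-monomial (suc k) (suc D) (s≤s k≤D) x = trans (+-identityˡ _) (*-congˡ (eval-monomial k D k≤D x))

  last-monomial-≡ : ∀ D → last (monomial D D) ≡ 1#
  last-monomial-≡ zero = ≡.refl
  last-monomial-≡ (suc D) = last-monomial-≡ D

  last-monomial-< : ∀ k D → k < D → last (monomial k D) ≡ 0#
  last-monomial-< zero (suc D) _ = last-replicate D 0#
  last-monomial-< (suc k) (suc D) (s≤s k<D) = last-monomial-< k D k<D

module Subfield {c ℓ} (F : CommutativeRing c ℓ) (isField : FieldDefs.IsField F)
  (q n : ℕ) (q-primePower : IsPrimePower q) (size : FieldDefs.HasSize F (q ℕ.^ suc n)) where
  open import Data.Product using (_×_)
  open CommutativeRing F renaming (Carrier to K) hiding (zero)
  open FieldDefs F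
  open import Algebra.Properties.Semiring.Exp semiring using (_^_; ^-congˡ; ^-assocʳ)
  open import Algebra.Properties.Monoid.Mult +-monoid using () renaming (_×_ to _·_)
  open import Algebra.Properties.Semiring.Mult semiring using (×1-homo-*)
  open import Algebra.Properties.Ring ring using (-1*x≈-x; x∙y⁻¹≈ε⇒x≈y; +-inverseˡ-unique)
  open import Relation.Binary.Reasoning.Setoid setoid
  open IntegerCoefficients F using (solve; _:+_; _:-_; _:=_)
  open FiniteField F isField size
  open Polynomials F isField _≟_
  open Frobenius F using (^-prime^-additive)

  private
    p = proj₁ q-primePower
    k = proj₁ (proj₂ q-primePower)
    p-prime : Prime p
    p-prime = proj₁ (proj₂ (proj₂ q-primePower))
    1≤k : 1 ≤ k
    1≤k = proj₁ (proj₂ (proj₂ (proj₂ q-primePower)))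
    q≡pᵏ : q ≡ p ℕ.^ k
    q≡pᵏ = proj₂ (proj₂ (proj₂ (proj₂ q-primePower)))

  1<q : 1 < q
  1<q = ≡.subst (1 <_) (≡.sym q≡pᵏ)
          (ℕ.^-monoʳ-< p (ℕ.nonTrivial⇒n>1 p {{prime⇒nonTrivial p-prime}}) 1≤k)

  private instance
    q≢0 : ℕ.NonZero q
    q≢0 = ℕ.>-nonZero (ℕ.<-trans (s≤s z≤n) 1<q)

  q^≡p^ : ∀ j → q ℕ.^ j ≡ p ℕ.^ (k ℕ.* j)
  q^≡p^ j = ≡.trans (≡.cong (ℕ._^ j) q≡pᵏ) (ℕ.^-*-assoc p k j)

  characteristic : p · 1# ≈ 0#
  characteristic = ^≈0⇒≈0 (k ℕ.* suc n) (begin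
    (p · 1#) ^ (k ℕ.* suc n)    ≈⟨ p^×1 (k ℕ.* suc n) ⟨
    (p ℕ.^ (k ℕ.* suc n)) · 1#  ≡⟨ ≡.cong (_· 1#) (q^≡p^ (suc n)) ⟨
    (q ℕ.^ suc n) · 1#          ≈⟨ size×≈0 1# ⟩
    0#                          ∎)
    where
    p^×1 : ∀ j → (p ℕ.^ j) · 1# ≈ (p · 1#) ^ j
    p^×1 zero = +-identityʳ 1#
    p^×1 (suc j) = trans (×1-homo-* p (p ℕ.^ j)) (*-congˡ (p^×1 j))

  ^q^-additive : ∀ j x y → (x + y) ^ (q ℕ.^ j) ≈ x ^ (q ℕ.^ j) + y ^ (q ℕ.^ j)
  ^q^-additive j x y rewrite q^≡p^ j = ^-prime^-additive p-prime characteristic (k ℕ.* j) x y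

  ^q^-neg : ∀ j y → (- y) ^ (q ℕ.^ j) ≈ - (y ^ (q ℕ.^ j))
  ^q^-neg j y = +-inverseˡ-unique _ _ (begin
    (- y) ^ (q ℕ.^ j) + y ^ (q ℕ.^ j)  ≈⟨ ^q^-additive j (- y) y ⟨
    (- y + y) ^ (q ℕ.^ j)              ≈⟨ ^-congˡ (q ℕ.^ j) (-‿inverseˡ y) ⟩
    0# ^ (q ℕ.^ j)                     ≈⟨ 0#^-nonzero (q ℕ.^ j) {{ℕ.m^n≢0 q j}} ⟩
    0#                                 ∎)

  ^q^-subtractive : ∀ j x y → (x - y) ^ (q ℕ.^ j) ≈ x ^ (q ℕ.^ j) - y ^ (q ℕ.^ j)
  ^q^-subtractive j x y = trans (^q^-additive j x (- y)) (+-congˡ (^q^-neg j y))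

  FixedBy : ℕ → K → Set ℓ
  FixedBy j x = x ^ (q ℕ.^ j) ≈ x

  fixedBy-shift : ∀ a {x} → FixedBy a x → ∀ b → x ^ (q ℕ.^ (a ℕ.+ b)) ≈ x ^ (q ℕ.^ b)
  fixedBy-shift a {x} fixed b = begin
    x ^ (q ℕ.^ (a ℕ.+ b))          ≡⟨ ≡.cong (x ^_) (ℕ.^-distribˡ-+-* q a b) ⟩
    x ^ (q ℕ.^ a ℕ.* q ℕ.^ b)      ≈⟨ ^-assocʳ x (q ℕ.^ a) (q ℕ.^ b) ⟨
    (x ^ (q ℕ.^ a)) ^ (q ℕ.^ b)    ≈⟨ ^-congˡ (q ℕ.^ b) fixed ⟩
    x ^ (q ℕ.^ b)                  ∎

  fixedBy-multiple : ∀ a {x} → FixedBy a x → ∀ t → FixedBy (a ℕ.* t) x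
  fixedBy-multiple a {x} fixed zero rewrite ℕ.*-zeroʳ a = *-identityʳ x
  fixedBy-multiple a {x} fixed (suc t) rewrite ℕ.*-suc a t =
    trans (fixedBy-shift a fixed (a ℕ.* t)) (fixedBy-multiple a fixed t)

  fixedBy-difference : ∀ u {v d x} → FixedBy u x → FixedBy v x → u ℕ.+ d ≡ v → FixedBy d x
  fixedBy-difference u {d = d} fixedᵘ fixedᵛ ≡.refl = trans (sym (fixedBy-shift u fixedᵘ d)) fixedᵛ

  fixedBy-gcd : ∀ a b {x} → FixedBy a x → FixedBy b x → FixedBy (gcd a b) x
  fixedBy-gcd a b fixedᵃ fixedᵇ with Bézout.identity (gcd-GCD a b)
  ... | Bézout.+- i j d+jb≡ia =
    fixedBy-difference (b ℕ.* j) (fixedBy-multiple b fixedᵇ j) (fixedBy-multiple a fixedᵃ i)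
      (≡.trans (ℕ.+-comm (b ℕ.* j) _) (≡.trans (≡.cong (gcd a b ℕ.+_) (ℕ.*-comm b j)) (≡.trans d+jb≡ia (ℕ.*-comm i a))))
  ... | Bézout.-+ i j d+ia≡jb =
    fixedBy-difference (a ℕ.* i) (fixedBy-multiple a fixedᵃ i) (fixedBy-multiple b fixedᵇ j)
      (≡.trans (ℕ.+-comm (a ℕ.* i) _) (≡.trans (≡.cong (gcd a b ℕ.+_) (ℕ.*-comm a i)) (≡.trans d+ia≡jb (ℕ.*-comm j b))))

  ^-≡ : ∀ x {i j} → i ≡ j → x ^ i ≈ x ^ j
  ^-≡ x ≡.refl = refl

  InFq⇒fixedBy1 : ∀ {x} → InFq q x → FixedBy 1 x
  InFq⇒fixedBy1 {x} xq≈x = trans (^-≡ x (ℕ.*-identityʳ q)) (trans (sym (pow≈^ x q)) xq≈x)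

  fixedBy1⇒InFq : ∀ {x} → FixedBy 1 x → InFq q x
  fixedBy1⇒InFq {x} fixed = trans (pow≈^ x q) (trans (^-≡ x (≡.sym (ℕ.*-identityʳ q))) fixed)

  -- Counting the fibres of the additive map φ, whose kernel is F_q and whose image
  -- lies among the q ^ n roots of the trace, gives q ^ (1 + n) ≤ |F_q| · q ^ n.
  φ : K → K
  φ x = x ^ q - x

  φ-cong : ∀ {x y} → x ≈ y → φ x ≈ φ y
  φ-cong x≈y = +-cong (^-congˡ q x≈y) (-‿cong x≈y)

  φ-sub : ∀ x y → φ (x - y) ≈ φ x - φ y
  φ-sub x y = begin
    (x - y) ^ q - (x - y)          ≈⟨ +-congʳ (^q-sub (^q^-subtractive 1 x y)) ⟩
    (x ^ q - y ^ q) - (x - y)      ≈⟨ solve 4 (λ a b x y → (a :- b) :- (x :- y) := (a :- x) :- (b :- y)) refl _ _ x y ⟩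
    (x ^ q - x) - (y ^ q - y)      ∎
    where
    ^q-sub : (x - y) ^ (q ℕ.^ 1) ≈ x ^ (q ℕ.^ 1) - y ^ (q ℕ.^ 1) → (x - y) ^ q ≈ x ^ q - y ^ q
    ^q-sub eq rewrite ℕ.*-identityʳ q = eq

  φ≈0⇔InFq : ∀ x → (φ x ≈ 0# → InFq q x) × (InFq q x → φ x ≈ 0#)
  φ≈0⇔InFq x = (λ φx≈0 → trans (pow≈^ x q) (x∙y⁻¹≈ε⇒x≈y _ _ φx≈0))
             , (λ xq≈x → trans (+-congʳ (trans (sym (pow≈^ x q)) xq≈x)) (-‿inverseʳ x))

  φᵖ : Vec K (suc q)
  φᵖ = zipWith _+_ (monomial q q) (map (- 1# *_) (monomial 1 q))

  eval-φᵖ : ∀ x → eval φᵖ x ≈ φ x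
  eval-φᵖ x = begin
    eval φᵖ x
      ≈⟨ eval-zipWith-+ (monomial q q) _ x ⟩
    eval (monomial q q) x + eval (map (- 1# *_) (monomial 1 q)) x
      ≈⟨ +-cong (eval-monomial q q ℕ.≤-refl x) (eval-map-* (- 1#) (monomial 1 q) x) ⟩
    x ^ q + - 1# * eval (monomial 1 q) x
      ≈⟨ +-congˡ (*-congˡ (eval-monomial 1 q (ℕ.<⇒≤ 1<q) x)) ⟩
    x ^ q + - 1# * (x * 1#)
      ≈⟨ +-congˡ (trans (-1*x≈-x _) (-‿cong (*-identityʳ x))) ⟩
    x ^ q - x ∎

  last-φᵖ : last φᵖ ≈ 1#
  last-φᵖ = begin
    last φᵖ
      ≡⟨ last-zipWith-+ (monomial q q) _ ⟩
    last (monomial q q) + last (map (- 1# *_) (monomial 1 q))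
      ≡⟨ ≡.cong₂ _+_ (last-monomial-≡ q) (last-map (- 1# *_) (monomial 1 q)) ⟩
    1# + - 1# * last (monomial 1 q)
      ≡⟨ ≡.cong (λ c → 1# + - 1# * c) (last-monomial-< 1 q 1<q) ⟩
    1# + - 1# * 0#
      ≈⟨ trans (+-congˡ (zeroʳ _)) (+-identityʳ 1#) ⟩
    1# ∎

  X^q^ : ℕ → Vec K (suc (q ℕ.^ n))
  X^q^ i = monomial (q ℕ.^ i) (q ℕ.^ n)

  traceᵖ : ℕ → Vec K (suc (q ℕ.^ n))
  traceᵖ zero = replicate _ 0#
  traceᵖ (suc i) = zipWith _+_ (traceᵖ i) (X^q^ i)

  eval-traceᵖ-φ : ∀ i → i ≤ suc n → ∀ x → eval (traceᵖ i) (φ x) ≈ x ^ (q ℕ.^ i) - x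
  eval-traceᵖ-φ zero _ x =
    trans (eval-replicate-0 (suc (q ℕ.^ n)) (φ x)) (sym (trans (+-congʳ (*-identityʳ x)) (-‿inverseʳ x)))
  eval-traceᵖ-φ (suc i) (s≤s i≤n) x = begin
    eval (traceᵖ (suc i)) (φ x)
      ≈⟨ eval-zipWith-+ (traceᵖ i) (X^q^ i) (φ x) ⟩
    eval (traceᵖ i) (φ x) + eval (X^q^ i) (φ x)
      ≈⟨ +-cong (eval-traceᵖ-φ i (ℕ.m≤n⇒m≤1+n i≤n) x) (eval-monomial _ _ (ℕ.^-monoʳ-≤ q i≤n) (φ x)) ⟩
    (x ^ (q ℕ.^ i) - x) + (x ^ q - x) ^ (q ℕ.^ i)
      ≈⟨ +-congˡ (^q^-subtractive i (x ^ q) x) ⟩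
    (x ^ (q ℕ.^ i) - x) + ((x ^ q) ^ (q ℕ.^ i) - x ^ (q ℕ.^ i))
      ≈⟨ +-congˡ (+-congʳ (^-assocʳ x q (q ℕ.^ i))) ⟩
    (x ^ (q ℕ.^ i) - x) + (x ^ (q ℕ.^ suc i) - x ^ (q ℕ.^ i))
      ≈⟨ solve 3 (λ a x b → (a :- x) :+ (b :- a) := b :- x) refl (x ^ (q ℕ.^ i)) x (x ^ (q ℕ.^ suc i)) ⟩
    x ^ (q ℕ.^ suc i) - x ∎

  last-traceᵖ : ∀ i → i ≤ n → last (traceᵖ i) ≈ 0#
  last-traceᵖ zero _ = reflexive (last-replicate (q ℕ.^ n) 0#)
  last-traceᵖ (suc i) i<n = begin
    last (traceᵖ (suc i))             ≡⟨ last-zipWith-+ (traceᵖ i) (X^q^ i) ⟩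
    last (traceᵖ i) + last (X^q^ i)   ≈⟨ +-cong (last-traceᵖ i (ℕ.<⇒≤ i<n))
                                                (reflexive (last-monomial-< _ _ (ℕ.^-monoʳ-< q 1<q i<n))) ⟩
    0# + 0#                           ≈⟨ +-identityˡ 0# ⟩
    0#                                ∎

  last-traceᵖ-top : last (traceᵖ (suc n)) ≈ 1#
  last-traceᵖ-top = begin
    last (traceᵖ (suc n))             ≡⟨ last-zipWith-+ (traceᵖ n) (X^q^ n) ⟩
    last (traceᵖ n) + last (X^q^ n)   ≈⟨ +-cong (last-traceᵖ n ℕ.≤-refl) (reflexive (last-monomial-≡ (q ℕ.^ n))) ⟩
    0# + 1#                           ≈⟨ +-identityˡ 1# ⟩
    1#                                ∎

  subfieldEnumeration : Enumeration (λ i → InFq q (e i)) q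
  subfieldEnumeration with enumerate (λ i → pow (e i) q ≟ e i)
  ... | a , Fq = ≡.subst (Enumeration _) (ℕ.≤-antisym a≤q q≤a) Fq
    where
    module Fq = Enumeration Fq
    a≤q : a ≤ q
    a≤q = roots≤degree q φᵖ (λ last≈0 → 1≉0 (trans (sym last-φᵖ) last≈0)) (λ i → e (Fq.at i))
      (λ i j eq → Fq.at-injective i j (e-injective _ _ eq))
      (λ i → trans (eval-φᵖ _) (proj₂ (φ≈0⇔InFq _) (Fq.at-member i)))
    q≤a : q ≤ a
    q≤a with enumerate (λ i → eval (traceᵖ (suc n)) (e i) ≟ 0#)
    ... | b , T = ℕ.*-cancelʳ-≤ q a (q ℕ.^ n) {{ℕ.m^n≢0 q n}} (ℕ.≤-trans fibres (ℕ.*-monoʳ-≤ a b≤qⁿ))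
      where
      fibres : q ℕ.^ suc n ≤ a ℕ.* b
      fibres = size≤kernel*image φ φ-cong φ-sub Fq T (λ i φeᵢ≈0 → proj₁ (φ≈0⇔InFq (e i)) φeᵢ≈0)
        (λ x → trans (eval-cong (traceᵖ (suc n)) (e-index (φ x))) (trans (eval-traceᵖ-φ (suc n) ℕ.≤-refl x)
                 (trans (+-congʳ (^-size x)) (-‿inverseʳ x))))
      module T = Enumeration T
      b≤qⁿ : b ≤ q ℕ.^ n
      b≤qⁿ = roots≤degree (q ℕ.^ n) (traceᵖ (suc n)) (λ last≈0 → 1≉0 (trans (sym last-traceᵖ-top) last≈0))
        (λ i → e (T.at i)) (λ i j eq → T.at-injective i j (e-injective _ _ eq)) (λ i → T.at-member i)

  module FrobeniusPower (m : ℕ) where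
    open import Algebra.Morphism.Structures using (module RingMorphisms)
    open RingMorphisms rawRing rawRing using (IsRingHomomorphism)
    open import Algebra.Properties.CommutativeSemiring.Exp commutativeSemiring using (^-distrib-*)

    σ≈^ : ∀ x → σ q m x ≈ x ^ (q ℕ.^ m)
    σ≈^ x = pow≈^ x (q ℕ.^ m)

    σ-isRingHomomorphism : IsRingHomomorphism (σ q m)
    σ-isRingHomomorphism = record
      { isSemiringHomomorphism = record
        { isNearSemiringHomomorphism = record
          { +-isMonoidHomomorphism = record
            { isMagmaHomomorphism = record
              { isRelHomomorphism = record { cong = λ x≈y → via (^-congˡ (q ℕ.^ m) x≈y) }
              ; homo = λ x y → trans (σ≈^ (x + y)) (trans (^q^-additive m x y) (sym (+-cong (σ≈^ x) (σ≈^ y)))) }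
            ; ε-homo = trans (σ≈^ 0#) (0#^-nonzero (q ℕ.^ m) {{ℕ.m^n≢0 q m}}) }
          ; *-homo = λ x y → trans (σ≈^ (x * y)) (trans (^-distrib-* x y (q ℕ.^ m)) (sym (*-cong (σ≈^ x) (σ≈^ y)))) }
        ; 1#-homo = trans (σ≈^ 1#) (1#^ (q ℕ.^ m)) }
      ; -‿homo = λ x → trans (σ≈^ (- x)) (trans (^q^-neg m x) (-‿cong (sym (σ≈^ x)))) }
      where
      via : ∀ {x y} → x ^ (q ℕ.^ m) ≈ y ^ (q ℕ.^ m) → σ q m x ≈ σ q m y
      via {x} {y} eq = trans (σ≈^ x) (trans eq (sym (σ≈^ y)))

    σ-fixed⇒InFq : gcd m (suc n) ≡ 1 → ∀ {x} → σ q m x ≈ x → InFq q x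
    σ-fixed⇒InFq coprime {x} σx≈x = fixedBy1⇒InFq (≡.subst (λ d → FixedBy d x) coprime
      (fixedBy-gcd m (suc n) (trans (sym (σ≈^ x)) σx≈x) (^-size x)))

    InFq⇒σ-fixed : ∀ {x} → InFq q x → σ q m x ≈ x
    InFq⇒σ-fixed {x} x∈Fq = trans (σ≈^ x)
      (≡.subst (λ d → FixedBy d x) (ℕ.*-identityˡ m) (fixedBy-multiple 1 (InFq⇒fixedBy1 x∈Fq) m))

module Vectors {c ℓ} (F : CommutativeRing c ℓ) where
  open CommutativeRing F renaming (Carrier to K) hiding (zero)
  open FieldDefs F
  open import Relation.Binary.Reasoning.Setoid setoid
  open IntegerCoefficients F using (solve; _:+_; _:*_; _:=_)

  infix 4 _≈ᵥ_
  _≈ᵥ_ : Vec3 → Vec3 → Set ℓ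
  X ≈ᵥ Y = ∀ i → X i ≈ Y i

  sum3-cong : ∀ {f g} → (∀ i → f i ≈ g i) → sum3 f ≈ sum3 g
  sum3-cong f≈g = +-cong (f≈g zero) (+-cong (f≈g (suc zero)) (f≈g (suc (suc zero))))

  sum3-linear : ∀ a b f g → sum3 (λ i → a * f i + b * g i) ≈ a * sum3 f + b * sum3 g
  sum3-linear a b f g = solve 8 (λ a b f₀ f₁ f₂ g₀ g₁ g₂ →
      (a :* f₀ :+ b :* g₀) :+ ((a :* f₁ :+ b :* g₁) :+ (a :* f₂ :+ b :* g₂))
    := a :* (f₀ :+ (f₁ :+ f₂)) :+ b :* (g₀ :+ (g₁ :+ g₂))) refl a b _ _ _ _ _ _

  onLine-lin : ∀ L a X b Y → OnLine L X → OnLine L Y → OnLine L (lin a X b Y)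
  onLine-lin L a X b Y X∈L Y∈L = begin
    sum3 (λ i → L i * (a * X i + b * Y i))          ≈⟨ sum3-cong (λ i → expand (L i) (X i) (Y i)) ⟩
    sum3 (λ i → a * (L i * X i) + b * (L i * Y i))  ≈⟨ sum3-linear a b (λ i → L i * X i) (λ i → L i * Y i) ⟩
    a * sum3 (λ i → L i * X i) + b * sum3 (λ i → L i * Y i) ≈⟨ +-cong (*-congˡ X∈L) (*-congˡ Y∈L) ⟩
    a * 0# + b * 0#                                 ≈⟨ trans (+-cong (zeroʳ a) (zeroʳ b)) (+-identityˡ 0#) ⟩
    0#                                              ∎
    where
    expand : ∀ l x y → l * (a * x + b * y) ≈ a * (l * x) + b * (l * y)
    expand = solve 5 (λ a b l x y → l :* (a :* x :+ b :* y) := a :* (l :* x) :+ b :* (l :* y)) refl a b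

  vec3 : K → K → K → Vec3
  vec3 a b c zero = a
  vec3 a b c (suc zero) = b
  vec3 a b c (suc (suc zero)) = c

  rotate : Vec3 → Vec3
  rotate X = vec3 (X (suc zero)) (X (suc (suc zero))) (X zero)

  dot-rotate : ∀ L X → sum3 (λ i → rotate L i * rotate X i) ≈ sum3 (λ i → L i * X i)
  dot-rotate L X = solve 3 (λ a b c → b :+ (c :+ a) := a :+ (b :+ c)) refl
    (L zero * X zero) (L (suc zero) * X (suc zero)) (L (suc (suc zero)) * X (suc (suc zero)))

module Sesquilinear {c ℓ} (F : CommutativeRing c ℓ) (τ : CommutativeRing.Carrier F → CommutativeRing.Carrier F)
  (τ-isRingHomomorphism : RingMorphisms.IsRingHomomorphism (CommutativeRing.rawRing F) (CommutativeRing.rawRing F) τ)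
  (A : FieldDefs.Mat3 F) where
  open CommutativeRing F renaming (Carrier to K) hiding (zero)
  open FieldDefs F
  open RingMorphisms.IsRingHomomorphism τ-isRingHomomorphism using (⟦⟧-cong; +-homo; *-homo; 0#-homo)
  open import Relation.Binary.Reasoning.Setoid setoid
  open IntegerCoefficients F using (solve; _:+_; _:*_; _:=_; :0)
  open Vectors F using (_≈ᵥ_; sum3-cong; sum3-linear)
  S : Vec3 → Vec3 → K
  S = sesq τ A

  Q : Vec3 → K
  Q X = S X X

  S-cong : ∀ {X X′ Y Y′} → X ≈ᵥ X′ → Y ≈ᵥ Y′ → S X Y ≈ S X′ Y′
  S-cong {X} {X′} {Y} {Y′} X≈X′ Y≈Y′ = sum3-cong (λ i → sum3-cong {λ j → X i * (A i j * τ (Y j))}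
    (λ j → *-cong (X≈X′ i) (*-congˡ (⟦⟧-cong (Y≈Y′ j)))))

  S-linearˡ : ∀ a Y b Z W → S (lin a Y b Z) W ≈ a * S Y W + b * S Z W
  S-linearˡ a Y b Z W = trans (sum3-cong (λ i → trans (sum3-cong (λ j → expand (Y i) (Z i) (A i j * τ (W j))))
                                                      (sum3-linear a b (term Y i) (term Z i))))
                              (sum3-linear a b (λ i → sum3 (term Y i)) (λ i → sum3 (term Z i)))
    where
    term : Vec3 → Fin 3 → Fin 3 → K
    term X i j = X i * (A i j * τ (W j))
    expand : ∀ y z w → (a * y + b * z) * w ≈ a * (y * w) + b * (z * w)
    expand = solve 5 (λ a b y z w → (a :* y :+ b :* z) :* w := a :* (y :* w) :+ b :* (z :* w)) refl a b

  S-semilinearʳ : ∀ X a Y b Z → S X (lin a Y b Z) ≈ τ a * S X Y + τ b * S X Z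
  S-semilinearʳ X a Y b Z = trans (sum3-cong (λ i → trans (sum3-cong (λ j → expand (X i) (A i j) (Y j) (Z j)))
                                                           (sum3-linear (τ a) (τ b) (term Y i) (term Z i))))
                                  (sum3-linear (τ a) (τ b) (λ i → sum3 (term Y i)) (λ i → sum3 (term Z i)))
    where
    term : Vec3 → Fin 3 → Fin 3 → K
    term W i j = X i * (A i j * τ (W j))
    expand : ∀ x aᵢⱼ y z → x * (aᵢⱼ * τ (a * y + b * z)) ≈ τ a * (x * (aᵢⱼ * τ y)) + τ b * (x * (aᵢⱼ * τ z))
    expand x aᵢⱼ y z = begin
      x * (aᵢⱼ * τ (a * y + b * z))               ≈⟨ *-congˡ (*-congˡ (trans (+-homo _ _) (+-cong (*-homo a y) (*-homo b z)))) ⟩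
      x * (aᵢⱼ * (τ a * τ y + τ b * τ z))         ≈⟨ solve 6 (λ x aᵢⱼ ta ty tb tz → x :* (aᵢⱼ :* (ta :* ty :+ tb :* tz))
                                                      := ta :* (x :* (aᵢⱼ :* ty)) :+ tb :* (x :* (aᵢⱼ :* tz))) refl x aᵢⱼ _ _ _ _ ⟩
      τ a * (x * (aᵢⱼ * τ y)) + τ b * (x * (aᵢⱼ * τ z)) ∎

  Q-lin : ∀ a Y b Z → Q (lin a Y b Z) ≈
    ((a * τ a) * Q Y + (a * τ b) * S Y Z) + ((b * τ a) * S Z Y + (b * τ b) * Q Z)
  Q-lin a Y b Z = begin
    S (lin a Y b Z) (lin a Y b Z)                                  ≈⟨ S-linearˡ a Y b Z (lin a Y b Z) ⟩
    a * S Y (lin a Y b Z) + b * S Z (lin a Y b Z)                  ≈⟨ +-cong (*-congˡ (S-semilinearʳ Y a Y b Z)) (*-congˡ (S-semilinearʳ Z a Y b Z)) ⟩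
    a * (τ a * Q Y + τ b * S Y Z) + b * (τ a * S Z Y + τ b * Q Z)  ≈⟨ solve 8 (λ a b ta tb yy yz zy zz →
          a :* (ta :* yy :+ tb :* yz) :+ b :* (ta :* zy :+ tb :* zz)
       := ((a :* ta) :* yy :+ (a :* tb) :* yz) :+ ((b :* ta) :* zy :+ (b :* tb) :* zz)) refl a b _ _ _ _ _ _ ⟩
    ((a * τ a) * Q Y + (a * τ b) * S Y Z) + ((b * τ a) * S Z Y + (b * τ b) * Q Z) ∎

  Q-scale : ∀ s X → Q (λ i → s * X i) ≈ (s * τ s) * Q X
  Q-scale s X = begin
    Q (λ i → s * X i)                                                         ≈⟨ S-cong s·X≈ s·X≈ ⟩
    Q (lin s X 0# X)                                                          ≈⟨ Q-lin s X 0# X ⟩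
    ((s * τ s) * Q X + (s * τ 0#) * Q X) + ((0# * τ s) * Q X + (0# * τ 0#) * Q X) ≈⟨ +-cong (+-congˡ (*-congʳ (*-congˡ 0#-homo))) refl ⟩
    ((s * τ s) * Q X + (s * 0#) * Q X) + ((0# * τ s) * Q X + (0# * τ 0#) * Q X)   ≈⟨ solve 4 (λ s ts q t0 →
          ((s :* ts) :* q :+ (s :* :0) :* q) :+ ((:0 :* ts) :* q :+ (:0 :* t0) :* q) := (s :* ts) :* q) refl s _ _ _ ⟩
    (s * τ s) * Q X                                                           ∎
    where
    s·X≈ : (λ i → s * X i) ≈ᵥ lin s X 0# X
    s·X≈ i = sym (trans (+-congˡ (zeroˡ _)) (+-identityʳ _))

  proportional-Q : ∀ {X Y} → Proportional X Y → Q Y ≈ 0# → Q X ≈ 0#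
  proportional-Q {X} {Y} (s , X≈sY) QY≈0 = trans (S-cong X≈sY X≈sY) (trans (Q-scale s Y) (trans (*-congˡ QY≈0) (zeroʳ _)))

module Lines {c ℓ} (F : CommutativeRing c ℓ) (isField : FieldDefs.IsField F)
  (_≟_ : Decidable (CommutativeRing._≈_ F)) where
  open import Data.Product using (_×_)
  open CommutativeRing F renaming (Carrier to K) hiding (zero)
  open FieldDefs F
  open DiscreteField F isField _≟_
  open import Relation.Binary.Reasoning.Setoid setoid
  open IntegerCoefficients F using (solve; _:+_; _:*_; _:-_; _:=_; :-_; :0)
  open Vectors F using (_≈ᵥ_; onLine-lin; vec3; rotate; dot-rotate)

  record LineBasis (L : Vec3) : Set (c ⊔ ℓ) where
    field
      U V : Vec3
      U∈L : OnLine L U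
      V∈L : OnLine L V
      independent : ∀ a b → lin a U b V ≈ᵥ (λ _ → 0#) → a ≈ 0# × b ≈ 0#
      spans : ∀ X → OnLine L X → Σ K λ a → Σ K λ b → X ≈ᵥ lin a U b V

  -- On the line, L₀ X = X₁ U + X₂ V.
  lineBasis₀ : ∀ L → L zero ≉ 0# → LineBasis L
  lineBasis₀ L L₀≉0 = record
    { U = U ; V = V
    ; U∈L = solve 3 (λ l₀ l₁ l₂ → l₀ :* (:- l₁) :+ (l₁ :* l₀ :+ l₂ :* :0) := :0) refl L₀ L₁ L₂
    ; V∈L = solve 3 (λ l₀ l₁ l₂ → l₀ :* (:- l₂) :+ (l₁ :* :0 :+ l₂ :* l₀) := :0) refl L₀ L₁ L₂
    ; independent = λ a b ab≈0 →
        *-cancelʳ-zero L₀≉0 (trans (solve 3 (λ a b l → a :* l := a :* l :+ b :* :0) refl a b L₀) (ab≈0 (suc zero)))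
      , *-cancelʳ-zero L₀≉0 (trans (solve 3 (λ a b l → b :* l := a :* :0 :+ b :* l) refl a b L₀) (ab≈0 (suc (suc zero))))
    ; spans = λ X X∈L → X₁ X * w , X₂ X * w , coordinates X X∈L }
    where
    L₀ = L zero
    L₁ = L (suc zero)
    L₂ = L (suc (suc zero))
    X₁ X₂ : Vec3 → K
    X₁ X = X (suc zero)
    X₂ X = X (suc (suc zero))
    U V : Vec3
    U = vec3 (- L₁) L₀ 0#
    V = vec3 (- L₂) 0# L₀
    w = L₀ ⁻¹⟨ L₀≉0 ⟩
    L₀w≈1 : L₀ * w ≈ 1#
    L₀w≈1 = *-inverseʳ L₀ L₀≉0
    coordinates : ∀ X → OnLine L X → X ≈ᵥ lin (X₁ X * w) U (X₂ X * w) V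
    coordinates X X∈L zero = begin
      X zero                                          ≈⟨ *-identityˡ _ ⟨
      1# * X zero                                     ≈⟨ *-congʳ L₀w≈1 ⟨
      (L₀ * w) * X zero                               ≈⟨ solve 7 (λ x₀ x₁ x₂ l₀ l₁ l₂ w →
          (l₀ :* w) :* x₀ := ((x₁ :* w) :* (:- l₁) :+ (x₂ :* w) :* (:- l₂)) :+ w :* (l₀ :* x₀ :+ (l₁ :* x₁ :+ l₂ :* x₂)))
          refl (X zero) (X₁ X) (X₂ X) L₀ L₁ L₂ w ⟩
      ((X₁ X * w) * - L₁ + (X₂ X * w) * - L₂) + w * sum3 (λ i → L i * X i)
                                                      ≈⟨ +-congˡ (trans (*-congˡ X∈L) (zeroʳ w)) ⟩
      ((X₁ X * w) * - L₁ + (X₂ X * w) * - L₂) + 0#    ≈⟨ +-identityʳ _ ⟩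
      (X₁ X * w) * - L₁ + (X₂ X * w) * - L₂           ∎
    coordinates X X∈L (suc zero) = sym (trans (solve 4 (λ x w l b → (x :* w) :* l :+ b :* :0 := (l :* w) :* x) refl (X₁ X) w L₀ (X₂ X * w))
                                              (trans (*-congʳ L₀w≈1) (*-identityˡ _)))
    coordinates X X∈L (suc (suc zero)) = sym (trans (solve 4 (λ x w l a → a :* :0 :+ (x :* w) :* l := (l :* w) :* x) refl (X₂ X) w L₀ (X₁ X * w))
                                                    (trans (*-congʳ L₀w≈1) (*-identityˡ _)))

  -- rotate has order 3, so rotating twice undoes it.
  lineBasis-unrotate : ∀ {L} → LineBasis (rotate L) → LineBasis L
  lineBasis-unrotate {L} B = record
    { U = unrotate U ; V = unrotate V
    ; U∈L = unrotate-onLine U U∈L ; V∈L = unrotate-onLine V V∈L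
    ; independent = λ a b ab≈0 → independent a b λ
        { zero → ab≈0 (suc zero) ; (suc zero) → ab≈0 (suc (suc zero)) ; (suc (suc zero)) → ab≈0 zero }
    ; spans = λ X X∈L → let (a , b , X≈ab) = spans (rotate X) (trans (dot-rotate L X) X∈L) in a , b , λ
        { zero → X≈ab (suc (suc zero)) ; (suc zero) → X≈ab zero ; (suc (suc zero)) → X≈ab (suc zero) } }
    where
    open LineBasis B
    unrotate : Vec3 → Vec3
    unrotate X = rotate (rotate X)
    unrotate-onLine : ∀ X → OnLine (rotate L) X → OnLine L (unrotate X)
    unrotate-onLine X X∈rotL = trans (sym (dot-rotate L (unrotate X))) X∈rotL

  lineBasis : ∀ L → NonZero L → LineBasis L
  lineBasis L (zero , L₀≉0) = lineBasis₀ L L₀≉0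
  lineBasis L (suc zero , L₁≉0) = lineBasis-unrotate (lineBasis₀ (rotate L) L₁≉0)
  lineBasis L (suc (suc zero) , L₂≉0) = lineBasis-unrotate (lineBasis-unrotate (lineBasis₀ (rotate (rotate L)) L₂≉0))

  det : K → K → K → K → K
  det a₁ b₁ a₂ b₂ = a₁ * b₂ - a₂ * b₁

  lin-lin : ∀ U V α₁ β₁ α₂ β₂ x y →
    lin x (lin α₁ U β₁ V) y (lin α₂ U β₂ V) ≈ᵥ lin (x * α₁ + y * α₂) U (x * β₁ + y * β₂) V
  lin-lin U V α₁ β₁ α₂ β₂ x y i = solve 8 (λ x y α₁ β₁ α₂ β₂ u v →
      x :* (α₁ :* u :+ β₁ :* v) :+ y :* (α₂ :* u :+ β₂ :* v)
    := (x :* α₁ :+ y :* α₂) :* u :+ (x :* β₁ :+ y :* β₂) :* v) refl x y α₁ β₁ α₂ β₂ (U i) (V i)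

  module Cramer (α₁ β₁ α₂ β₂ : K) (D≉0 : det α₁ β₁ α₂ β₂ ≉ 0#) where
    private
      D = det α₁ β₁ α₂ β₂
      w = D ⁻¹⟨ D≉0 ⟩
      Dw≈1 : D * w ≈ 1#
      Dw≈1 = *-inverseʳ D D≉0

    kernel-trivial : ∀ x y → x * α₁ + y * α₂ ≈ 0# → x * β₁ + y * β₂ ≈ 0# → x ≈ 0# × y ≈ 0#
    kernel-trivial x y first≈0 second≈0 =
        *-cancelʳ-zero D≉0 (trans (solve 6 (λ x y α₁ β₁ α₂ β₂ →
          x :* (α₁ :* β₂ :- α₂ :* β₁) := (x :* α₁ :+ y :* α₂) :* β₂ :- (x :* β₁ :+ y :* β₂) :* α₂) refl x y α₁ β₁ α₂ β₂)
          (null first≈0 second≈0))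
      , *-cancelʳ-zero D≉0 (trans (solve 6 (λ x y α₁ β₁ α₂ β₂ →
          y :* (α₁ :* β₂ :- α₂ :* β₁) := (x :* β₁ :+ y :* β₂) :* α₁ :- (x :* α₁ :+ y :* α₂) :* β₁) refl x y α₁ β₁ α₂ β₂)
          (null second≈0 first≈0))
      where
      null : ∀ {u v s t} → u ≈ 0# → v ≈ 0# → u * s - v * t ≈ 0#
      null {u} {v} {s} {t} u≈0 v≈0 = trans (+-cong (trans (*-congʳ u≈0) (zeroˡ s)) (-‿cong (trans (*-congʳ v≈0) (zeroˡ t))))
                                           (-‿inverseʳ 0#)

    solution₁ solution₂ : K → K → K
    solution₁ a b = (a * β₂ - α₂ * b) * w
    solution₂ a b = (α₁ * b - a * β₁) * w

    solves₁ : ∀ a b → solution₁ a b * α₁ + solution₂ a b * α₂ ≈ a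
    solves₁ a b = trans (solve 7 (λ a b α₁ β₁ α₂ β₂ w →
        ((a :* β₂ :- α₂ :* b) :* w) :* α₁ :+ ((α₁ :* b :- a :* β₁) :* w) :* α₂ := ((α₁ :* β₂ :- α₂ :* β₁) :* w) :* a)
      refl a b α₁ β₁ α₂ β₂ w) (trans (*-congʳ Dw≈1) (*-identityˡ a))

    solves₂ : ∀ a b → solution₁ a b * β₁ + solution₂ a b * β₂ ≈ b
    solves₂ a b = trans (solve 7 (λ a b α₁ β₁ α₂ β₂ w →
        ((a :* β₂ :- α₂ :* b) :* w) :* β₁ :+ ((α₁ :* b :- a :* β₁) :* w) :* β₂ := ((α₁ :* β₂ :- α₂ :* β₁) :* w) :* b)
      refl a b α₁ β₁ α₂ β₂ w) (trans (*-congʳ Dw≈1) (*-identityˡ b))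

  changeBasis : ∀ {L} → LineBasis L → ∀ α₁ β₁ α₂ β₂ → det α₁ β₁ α₂ β₂ ≉ 0# → LineBasis L
  changeBasis {L} B α₁ β₁ α₂ β₂ D≉0 = record
    { U = lin α₁ U β₁ V ; V = lin α₂ U β₂ V
    ; U∈L = onLine-lin L α₁ U β₁ V U∈L V∈L
    ; V∈L = onLine-lin L α₂ U β₂ V U∈L V∈L
    ; independent = λ x y xy≈0 →
        let (first≈0 , second≈0) = independent _ _ (λ i → trans (sym (lin-lin U V α₁ β₁ α₂ β₂ x y i)) (xy≈0 i))
        in kernel-trivial x y first≈0 second≈0
    ; spans = λ X X∈L → let (a , b , X≈ab) = spans X X∈L in solution₁ a b , solution₂ a b ,
        λ i → trans (X≈ab i) (sym (trans (lin-lin U V α₁ β₁ α₂ β₂ _ _ i)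
                (+-cong (*-congʳ (solves₁ a b)) (*-congʳ (solves₂ a b))))) }
    where
    open LineBasis B
    open Cramer α₁ β₁ α₂ β₂ D≉0

  nonZero : ∀ X → ¬ (X ≈ᵥ (λ _ → 0#)) → NonZero X
  nonZero X X≉0 with X zero ≟ 0# | X (suc zero) ≟ 0# | X (suc (suc zero)) ≟ 0#
  ... | no X₀≉0 | _ | _ = zero , X₀≉0
  ... | yes _ | no X₁≉0 | _ = suc zero , X₁≉0
  ... | yes _ | yes _ | no X₂≉0 = suc (suc zero) , X₂≉0
  ... | yes X₀≈0 | yes X₁≈0 | yes X₂≈0 =
    ⊥-elim (X≉0 λ { zero → X₀≈0 ; (suc zero) → X₁≈0 ; (suc (suc zero)) → X₂≈0 })

  module _ {L} (B : LineBasis L) where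
    open LineBasis B

    lin-nonZero : ∀ {a b} → ¬ (a ≈ 0# × b ≈ 0#) → NonZero (lin a U b V)
    lin-nonZero ab≉0 = nonZero _ (λ ab≈0 → ab≉0 (independent _ _ ab≈0))

    det-proportional : ∀ {a b a′ b′} → Proportional (lin a U b V) (lin a′ U b′ V) → det a b a′ b′ ≈ 0#
    det-proportional {a} {b} {a′} {b′} (s , ab≈s·a′b′) = begin
      a * b′ - a′ * b                  ≈⟨ +-cong (*-congʳ (x∙y⁻¹≈ε⇒x≈y _ _ a-sa′≈0)) (-‿cong (*-congˡ (x∙y⁻¹≈ε⇒x≈y _ _ b-sb′≈0))) ⟩
      (s * a′) * b′ - a′ * (s * b′)    ≈⟨ solve 3 (λ s a b → (s :* a) :* b :- a :* (s :* b) := :0) refl s a′ b′ ⟩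
      0#                               ∎
      where
      open import Algebra.Properties.Ring ring using (x∙y⁻¹≈ε⇒x≈y)
      difference = independent (a - s * a′) (b - s * b′) (λ i → begin
        (a - s * a′) * U i + (b - s * b′) * V i  ≈⟨ solve 7 (λ a b a′ b′ s u v →
            (a :- s :* a′) :* u :+ (b :- s :* b′) :* v := (a :* u :+ b :* v) :- s :* (a′ :* u :+ b′ :* v))
            refl a b a′ b′ s (U i) (V i) ⟩
        lin a U b V i - s * lin a′ U b′ V i      ≈⟨ +-congʳ (ab≈s·a′b′ i) ⟩
        s * lin a′ U b′ V i - s * lin a′ U b′ V i ≈⟨ -‿inverseʳ _ ⟩
        0#                                       ∎)
      a-sa′≈0 = proj₁ difference
      b-sb′≈0 = proj₂ difference

  -- The zeros of a form G on the projective line: the points (x j : y j), pairwise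
  -- distinct since det ≉ 0; in AffineZeros the points (x j : 1).
  record ProjectiveZeros (G : K → K → K) (t : ℕ) : Set (c ⊔ ℓ) where
    field
      x y : Fin t → K
      isZero : ∀ j → G (x j) (y j) ≈ 0#
      nonzero : ∀ j → ¬ (x j ≈ 0# × y j ≈ 0#)
      distinct : ∀ j j′ → j ≢ j′ → det (x j) (y j) (x j′) (y j′) ≉ 0#
      complete : ∀ a b → ¬ (a ≈ 0# × b ≈ 0#) → G a b ≈ 0# →
        Σ (Fin t) λ j → Σ K λ s → a ≈ s * x j × b ≈ s * y j

  record AffineZeros (G : K → K → K) (t : ℕ) : Set (c ⊔ ℓ) where
    field
      x : Fin t → K
      injective : ∀ i j → x i ≈ x j → i ≡ j
      isZero : ∀ j → G (x j) 1# ≈ 0#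
      complete : ∀ z → G z 1# ≈ 0# → Σ (Fin t) λ j → z ≈ x j

module Conic {c ℓ} (F : CommutativeRing c ℓ) (isField : FieldDefs.IsField F)
  {N : ℕ} (size : FieldDefs.HasSize F N) (τ : CommutativeRing.Carrier F → CommutativeRing.Carrier F)
  (τ-isRingHomomorphism : RingMorphisms.IsRingHomomorphism (CommutativeRing.rawRing F) (CommutativeRing.rawRing F) τ)
  (A : FieldDefs.Mat3 F) where
  open import Data.Product using (_×_)
  open CommutativeRing F renaming (Carrier to K) hiding (zero)
  open FieldDefs F
  open RingMorphisms.IsRingHomomorphism τ-isRingHomomorphism using (⟦⟧-cong; *-homo; 0#-homo; 1#-homo)
  open import Relation.Binary.Reasoning.Setoid setoid
  open IntegerCoefficients F using (solve; _:+_; _:*_; _:-_; _:=_; :-_; :0)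
  open FiniteField F isField size
  open Vectors F
  open Lines F isField _≟_
  open Sesquilinear F τ τ-isRingHomomorphism A

  τ-nonzero : ∀ {s} → s ≉ 0# → τ s ≉ 0#
  τ-nonzero {s} s≉0 τs≈0 = 1≉0 (begin
    1#                      ≈⟨ 1#-homo ⟨
    τ 1#                    ≈⟨ ⟦⟧-cong (*-inverseʳ s s≉0) ⟨
    τ (s * s ⁻¹⟨ s≉0 ⟩)     ≈⟨ *-homo _ _ ⟩
    τ s * τ (s ⁻¹⟨ s≉0 ⟩)   ≈⟨ *-congʳ τs≈0 ⟩
    0# * τ (s ⁻¹⟨ s≉0 ⟩)    ≈⟨ zeroˡ _ ⟩
    0#                      ∎)

  module LineForm {L : Vec3} (B : LineBasis L) where
    open LineBasis B

    form : K → K → K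
    form a b = Q (lin a U b V)

    form-cong : ∀ {a a′ b b′} → a ≈ a′ → b ≈ b′ → form a b ≈ form a′ b′
    form-cong {a} {a′} {b} {b′} a≈a′ b≈b′ = S-cong ab≈ ab≈
      where
      ab≈ : lin a U b V ≈ᵥ lin a′ U b′ V
      ab≈ i = +-cong (*-congʳ a≈a′) (*-congʳ b≈b′)

    form-scale : ∀ s a b → form (s * a) (s * b) ≈ (s * τ s) * form a b
    form-scale s a b = trans (S-cong sab≈ sab≈) (Q-scale s (lin a U b V))
      where
      sab≈ : lin (s * a) U (s * b) V ≈ᵥ (λ i → s * lin a U b V i)
      sab≈ i = solve 5 (λ s a b u v → (s :* a) :* u :+ (s :* b) :* v := s :* (a :* u :+ b :* v)) refl s a b (U i) (V i)

    form-scale-zero : ∀ {s a b} → s ≉ 0# → form (s * a) (s * b) ≈ 0# → form a b ≈ 0#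
    form-scale-zero {s} {a} {b} s≉0 zero′ =
      *-cancelˡ-zero (*-nonzero s≉0 (τ-nonzero s≉0)) (trans (sym (form-scale s a b)) zero′)

    meetsIn : ∀ {t} → ProjectiveZeros form t → MeetsIn τ A L t
    meetsIn {t} Z = P , (λ j → lin-nonZero B (nonzero j) , onLine-lin L (x j) U (y j) V U∈L V∈L , isZero j)
                      , distinct′ , complete′
      where
      open ProjectiveZeros Z
      P : Fin t → Vec3
      P j = lin (x j) U (y j) V
      distinct′ : ∀ j j′ → Proportional (P j) (P j′) → j ≡ j′
      distinct′ j j′ Pj∝Pj′ with j Fin.≟ j′
      ... | yes j≡j′ = j≡j′
      ... | no j≢j′ = ⊥-elim (distinct j j′ j≢j′ (det-proportional B Pj∝Pj′))
      complete′ : ∀ X → NonZero X → OnLine L X → InΓ τ A X → Σ (Fin t) λ j → Proportional X (P j)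
      complete′ X (i , Xᵢ≉0) X∈L X∈Γ =
        let (a , b , X≈ab) = spans X X∈L
            (j , s , a≈sx , b≈sy) = complete a b (ab≉0 a b X≈ab) (trans (sym (S-cong X≈ab X≈ab)) X∈Γ)
        in j , s , λ k → trans (X≈ab k) (trans (+-cong (*-congʳ a≈sx) (*-congʳ b≈sy))
             (solve 5 (λ s a b u v → (s :* a) :* u :+ (s :* b) :* v := s :* (a :* u :+ b :* v)) refl s (x j) (y j) (U k) (V k)))
        where
        ab≉0 : ∀ a b → X ≈ᵥ lin a U b V → ¬ (a ≈ 0# × b ≈ 0#)
        ab≉0 a b X≈ab (a≈0 , b≈0) = Xᵢ≉0 (trans (X≈ab i)
          (trans (+-cong (trans (*-congʳ a≈0) (zeroˡ _)) (trans (*-congʳ b≈0) (zeroˡ _))) (+-identityˡ 0#)))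

    private
      affine-complete : ∀ {t} (Z : AffineZeros form t) a b → b ≉ 0# → form a b ≈ 0# →
        Σ (Fin t) λ j → a ≈ b * AffineZeros.x Z j × b ≈ b * 1#
      affine-complete Z a b b≉0 form≈0 =
        let (j , a/b≈xⱼ) = complete (a * b ⁻¹⟨ b≉0 ⟩) (form-scale-zero b≉0 (trans (form-cong (sym a≈b·a/b) (*-identityʳ b)) form≈0))
        in j , trans a≈b·a/b (*-congˡ a/b≈xⱼ) , sym (*-identityʳ b)
        where
        open AffineZeros Z
        a≈b·a/b : a ≈ b * (a * b ⁻¹⟨ b≉0 ⟩)
        a≈b·a/b = sym (trans (solve 3 (λ b a w → b :* (a :* w) := (b :* w) :* a) refl b a _)
                              (trans (*-congʳ (*-inverseʳ b b≉0)) (*-identityˡ a)))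

      affine-distinct : ∀ {t} (Z : AffineZeros form t) i j → i ≢ j →
        det (AffineZeros.x Z i) 1# (AffineZeros.x Z j) 1# ≉ 0#
      affine-distinct Z i j i≢j D≈0 = i≢j (AffineZeros.injective Z i j
        (x∙y⁻¹≈ε⇒x≈y _ _ (trans (+-cong (sym (*-identityʳ _)) (-‿cong (sym (*-identityʳ _)))) D≈0)))
        where open import Algebra.Properties.Ring ring using (x∙y⁻¹≈ε⇒x≈y)

    withoutInfinity : ∀ {t} → AffineZeros form t → form 1# 0# ≉ 0# → ProjectiveZeros form t
    withoutInfinity Z ∞∉Γ = record
      { x = x ; y = λ _ → 1# ; isZero = isZero ; nonzero = λ _ (_ , 1≈0) → 1≉0 1≈0
      ; distinct = affine-distinct Z ; complete = complete′ }
      where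
      open AffineZeros Z
      complete′ : ∀ a b → ¬ (a ≈ 0# × b ≈ 0#) → form a b ≈ 0# → Σ _ λ j → Σ K λ s → a ≈ s * x j × b ≈ s * 1#
      complete′ a b ab≉0 form≈0 with b ≟ 0#
      ... | yes b≈0 = ⊥-elim (∞∉Γ (form-scale-zero a≉0 (trans (form-cong (*-identityʳ a) (trans (zeroʳ a) (sym b≈0))) form≈0)))
        where a≉0 = λ a≈0 → ab≉0 (a≈0 , b≈0)
      ... | no b≉0 = let (j , eqs) = affine-complete Z a b b≉0 form≈0 in j , b , eqs

    withInfinity : ∀ {t} → AffineZeros form t → form 1# 0# ≈ 0# → ProjectiveZeros form (suc t)
    withInfinity {t} Z ∞∈Γ = record
      { x = x′ ; y = y′ ; isZero = isZero′ ; nonzero = nonzero′ ; distinct = distinct′ ; complete = complete′ }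
      where
      open AffineZeros Z
      x′ y′ : Fin (suc t) → K
      x′ zero = 1#
      x′ (suc j) = x j
      y′ zero = 0#
      y′ (suc j) = 1#
      isZero′ : ∀ j → form (x′ j) (y′ j) ≈ 0#
      isZero′ zero = ∞∈Γ
      isZero′ (suc j) = isZero j
      nonzero′ : ∀ j → ¬ (x′ j ≈ 0# × y′ j ≈ 0#)
      nonzero′ zero (1≈0 , _) = 1≉0 1≈0
      nonzero′ (suc j) (_ , 1≈0) = 1≉0 1≈0
      open import Algebra.Properties.Ring ring using (-0#≈0#; -‿injective)
      det-∞ : ∀ z → det 1# 0# z 1# ≈ 1#
      det-∞ z = trans (+-cong (*-identityˡ 1#) (trans (-‿cong (zeroʳ z)) -0#≈0#)) (+-identityʳ 1#)
      det-∞′ : ∀ z → det z 1# 1# 0# ≈ - 1#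
      det-∞′ z = trans (+-cong (zeroʳ z) (-‿cong (*-identityˡ 1#))) (+-identityˡ _)
      distinct′ : ∀ j j′ → j ≢ j′ → det (x′ j) (y′ j) (x′ j′) (y′ j′) ≉ 0#
      distinct′ zero zero j≢j′ _ = j≢j′ ≡.refl
      distinct′ zero (suc j′) _ D≈0 = 1≉0 (trans (sym (det-∞ (x j′))) D≈0)
      distinct′ (suc j) zero _ D≈0 = 1≉0 (-‿injective (trans (sym (det-∞′ (x j))) (trans D≈0 (sym -0#≈0#))))
      distinct′ (suc j) (suc j′) j≢j′ = affine-distinct Z j j′ (λ j≡j′ → j≢j′ (≡.cong suc j≡j′))
      complete′ : ∀ a b → ¬ (a ≈ 0# × b ≈ 0#) → form a b ≈ 0# → Σ _ λ j → Σ K λ s → a ≈ s * x′ j × b ≈ s * y′ j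
      complete′ a b ab≉0 form≈0 with b ≟ 0#
      ... | yes b≈0 = zero , a , sym (*-identityʳ a) , trans b≈0 (sym (zeroʳ a))
      ... | no b≉0 = let (j , eqs) = affine-complete Z a b b≉0 form≈0 in suc j , b , eqs

    affineZeros : ∃ (AffineZeros form)
    affineZeros with enumerate (λ i → form (e i) 1# ≟ 0#)
    ... | t , E = t , record
      { x = λ j → e (at j)
      ; injective = λ i j eq → at-injective i j (e-injective _ _ eq)
      ; isZero = at-member
      ; complete = λ z z∈Γ → enumerated E (trans (form-cong (e-index z) refl) z∈Γ) }
      where open Enumeration E

    projectiveZeros : ∃ (ProjectiveZeros form)
    projectiveZeros with affineZeros | form 1# 0# ≟ 0#
    ... | t , Z | yes ∞∈Γ = suc t , withInfinity Z ∞∈Γ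
    ... | t , Z | no ∞∉Γ = t , withoutInfinity Z ∞∉Γ

    -- If U, V and U + V are isotropic then S U V = - S V U, which determines the form.
    form-isotropic : Q U ≈ 0# → Q V ≈ 0# → form 1# 1# ≈ 0# → ∀ a b → form a b ≈ S V U * (b * τ a - a * τ b)
    form-isotropic QU≈0 QV≈0 form₁₁≈0 a b = begin
      form a b                                                                          ≈⟨ Q-lin a U b V ⟩
      ((a * τ a) * Q U + (a * τ b) * S U V) + ((b * τ a) * S V U + (b * τ b) * Q V)  ≈⟨ +-cong (+-cong (*-congˡ QU≈0) (*-congˡ β≈-γ))
                                                                                              (+-congˡ (*-congˡ QV≈0)) ⟩
      ((a * τ a) * 0# + (a * τ b) * - S V U) + ((b * τ a) * S V U + (b * τ b) * 0#)  ≈⟨ solve 5 (λ a b ta tb γ →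
          ((a :* ta) :* :0 :+ (a :* tb) :* (:- γ)) :+ ((b :* ta) :* γ :+ (b :* tb) :* :0) := γ :* (b :* ta :- a :* tb))
          refl a b (τ a) (τ b) (S V U) ⟩
      S V U * (b * τ a - a * τ b)                                                       ∎
      where
      open import Algebra.Properties.Ring ring using (+-inverseˡ-unique)
      one : ∀ z → (1# * τ 1#) * z ≈ z
      one z = trans (*-congʳ (trans (*-identityˡ _) 1#-homo)) (*-identityˡ z)
      β≈-γ : S U V ≈ - S V U
      β≈-γ = +-inverseˡ-unique _ _ (begin
        S U V + S V U                                      ≈⟨ +-cong (+-identityˡ _) (+-identityʳ _) ⟨
        (0# + S U V) + (S V U + 0#)                        ≈⟨ +-cong (+-cong (trans (one _) QU≈0) (one _))
                                                                     (+-cong (one _) (trans (one _) QV≈0)) ⟨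
        ((1# * τ 1#) * Q U + (1# * τ 1#) * S U V) + ((1# * τ 1#) * S V U + (1# * τ 1#) * Q V)
                                                           ≈⟨ Q-lin 1# U 1# V ⟨
        form 1# 1#                                         ≈⟨ form₁₁≈0 ⟩
        0#                                                 ∎)

  record IsotropicBasis (L : Vec3) : Set (c ⊔ ℓ) where
    field
      basis : LineBasis L
    open LineBasis basis public
    open LineForm basis public
    field
      U-isotropic : Q U ≈ 0#
      V-isotropic : Q V ≈ 0#
      U+V-isotropic : form 1# 1# ≈ 0#

  -- Rescale the first two of three zeros P₁, P₂, P₃ so that P₃ = P₁ + P₂.
  isotropicBasis : ∀ {L} (B : LineBasis L) {t} → ProjectiveZeros (LineForm.form B) (3 ℕ.+ t) → IsotropicBasis L
  isotropicBasis {L} B Z = record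
    { basis = changeBasis B₁ s 0# 0# t st≉0
    ; U-isotropic = proportional-Q {Y = P j₁} (s , λ i → trans (+-congˡ (zeroˡ (P j₂ i))) (+-identityʳ _)) (isZero j₁)
    ; V-isotropic = proportional-Q {Y = P j₂} (t , λ i → trans (+-congʳ (zeroˡ (P j₁ i))) (+-identityˡ _)) (isZero j₂)
    ; U+V-isotropic = trans (S-cong P₃≈ P₃≈) (isZero j₃) }
    where
    open LineBasis B
    open ProjectiveZeros Z
    j₁ j₂ j₃ : Fin (3 ℕ.+ _)
    j₁ = zero
    j₂ = suc zero
    j₃ = suc (suc zero)
    P : Fin (3 ℕ.+ _) → Vec3
    P j = lin (x j) U (y j) V
    B₁ = changeBasis B (x j₁) (y j₁) (x j₂) (y j₂) (distinct j₁ j₂ (λ ()))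
    P₃-coordinates = LineBasis.spans B₁ (P j₃) (onLine-lin L (x j₃) U (y j₃) V U∈L V∈L)
    s = proj₁ P₃-coordinates
    t = proj₁ (proj₂ P₃-coordinates)
    P₃≈sP₁+tP₂ : P j₃ ≈ᵥ lin s (P j₁) t (P j₂)
    P₃≈sP₁+tP₂ = proj₂ (proj₂ P₃-coordinates)
    s≉0 : s ≉ 0#
    s≉0 s≈0 = distinct j₃ j₂ (λ ()) (det-proportional B (t , λ i →
      trans (P₃≈sP₁+tP₂ i) (trans (+-congʳ (trans (*-congʳ s≈0) (zeroˡ _))) (+-identityˡ _))))
    t≉0 : t ≉ 0#
    t≉0 t≈0 = distinct j₃ j₁ (λ ()) (det-proportional B (s , λ i →
      trans (P₃≈sP₁+tP₂ i) (trans (+-congˡ (trans (*-congʳ t≈0) (zeroˡ _))) (+-identityʳ _))))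
    st≉0 : det s 0# 0# t ≉ 0#
    st≉0 D≈0 = *-nonzero s≉0 t≉0 (trans (solve 2 (λ s t → s :* t := s :* t :- :0 :* :0) refl s t) D≈0)
    P₃≈ : lin 1# (lin s (P j₁) 0# (P j₂)) 1# (lin 0# (P j₁) t (P j₂)) ≈ᵥ P j₃
    P₃≈ i = trans (+-cong (trans (*-identityˡ _) (trans (+-congˡ (zeroˡ _)) (+-identityʳ _)))
                          (trans (*-identityˡ _) (trans (+-congʳ (zeroˡ _)) (+-identityˡ _))))
                  (sym (P₃≈sP₁+tP₂ i))

  module _ (q : ℕ) (fixed⇒InFq : ∀ {x} → τ x ≈ x → InFq q x) (InFq⇒fixed : ∀ {x} → InFq q x → τ x ≈ x)
           (Fq : Enumeration (λ i → InFq q (e i)) q) where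

    -- Relative to an isotropic basis with S V U ≉ 0 the zeros of the form are the
    -- points (a : b) with a τ b = b τ a, i.e. those with coordinates in F_q.
    module RationalPoints {L} (I : IsotropicBasis L) (γ≉0 : S (IsotropicBasis.V I) (IsotropicBasis.U I) ≉ 0#) where
      open IsotropicBasis I

      form≈ : ∀ a b → form a b ≈ S V U * (b * τ a - a * τ b)
      form≈ = form-isotropic U-isotropic V-isotropic U+V-isotropic

      fixed-zero : ∀ a b → τ a ≈ a → τ b ≈ b → form a b ≈ 0#
      fixed-zero a b τa≈a τb≈b = trans (form≈ a b) (trans (*-congˡ (trans (+-cong (*-congˡ τa≈a) (-‿cong (*-congˡ τb≈b)))
        (solve 2 (λ a b → b :* a :- a :* b := :0) refl a b))) (zeroʳ _))

      zero⇒fixed : ∀ z → form z 1# ≈ 0# → τ z ≈ z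
      zero⇒fixed z z∈Γ = trans (sym (*-identityˡ _)) (trans (x∙y⁻¹≈ε⇒x≈y _ _ (*-cancelˡ-zero γ≉0 (trans (sym (form≈ z 1#)) z∈Γ)))
                           (trans (*-congˡ 1#-homo) (*-identityʳ z)))
        where open import Algebra.Properties.Ring ring using (x∙y⁻¹≈ε⇒x≈y)

      rationalZeros : AffineZeros form q
      rationalZeros = record
        { x = λ j → e (Enumeration.at Fq j)
        ; injective = λ i j eq → Enumeration.at-injective Fq i j (e-injective _ _ eq)
        ; isZero = λ j → fixed-zero _ 1# (InFq⇒fixed (Enumeration.at-member Fq j)) 1#-homo
        ; complete = λ z z∈Γ → enumerated Fq (fixed⇒InFq (trans (⟦⟧-cong (e-index z)) (trans (zero⇒fixed z z∈Γ) (sym (e-index z))))) }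

      zeros : ProjectiveZeros form (suc q)
      zeros = withInfinity rationalZeros (fixed-zero 1# 0# 1#-homo 0#-homo)

      meets : MeetsIn τ A L (suc q)
      meets = meetsIn zeros

      coordinates-in-Fq : ∀ j → InFq q (ProjectiveZeros.x zeros j) × InFq q (ProjectiveZeros.y zeros j)
      coordinates-in-Fq zero = fixed⇒InFq 1#-homo , fixed⇒InFq 0#-homo
      coordinates-in-Fq (suc j) = Enumeration.at-member Fq j , fixed⇒InFq 1#-homo

      isFqSubline : IsFqSubline q τ A L
      isFqSubline = U , V , nonZero U (basis-nonzero 1# 0# lin10≈U proj₁) , nonZero V (basis-nonzero 0# 1# lin01≈V proj₂)
        , U∈L , V∈L , independent
        , λ X X≉0 X∈L →
            (λ X∈Γ → let (j , X∝Pⱼ) = proj₂ (proj₂ (proj₂ meets)) X X≉0 X∈L X∈Γ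
                         (a∈Fq , b∈Fq) = coordinates-in-Fq j
                     in _ , _ , a∈Fq , b∈Fq , proj₁ (proj₁ (proj₂ meets) j) , X∝Pⱼ)
          , λ (a , b , a∈Fq , b∈Fq , _ , X∝ab) → proportional-Q X∝ab (fixed-zero a b (InFq⇒fixed a∈Fq) (InFq⇒fixed b∈Fq))
        where
        lin10≈U : lin 1# U 0# V ≈ᵥ U
        lin10≈U i = trans (+-cong (*-identityˡ _) (zeroˡ _)) (+-identityʳ _)
        lin01≈V : lin 0# U 1# V ≈ᵥ V
        lin01≈V i = trans (+-cong (zeroˡ _) (*-identityˡ _)) (+-identityˡ _)
        basis-nonzero : ∀ a b {W} → lin a U b V ≈ᵥ W → (a ≈ 0# × b ≈ 0# → 1# ≈ 0#) → ¬ (W ≈ᵥ (λ _ → 0#))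
        basis-nonzero a b ab≈W one W≈0 = 1≉0 (one (independent a b (λ i → trans (ab≈W i) (W≈0 i))))

    isotropic-classification : ∀ {L} → IsotropicBasis L →
      LineInΓ τ A L ⊎ (MeetsIn τ A L (q ℕ.+ 1) × IsFqSubline q τ A L)
    isotropic-classification {L} I = by-γ (S V U ≟ 0#)
      where
      open IsotropicBasis I
      by-γ : Dec (S V U ≈ 0#) → LineInΓ τ A L ⊎ (MeetsIn τ A L (q ℕ.+ 1) × IsFqSubline q τ A L)
      by-γ (yes γ≈0) = inj₁ λ X _ X∈L →
        let (a , b , X≈ab) = spans X X∈L
        in trans (S-cong X≈ab X≈ab) (trans (form-isotropic U-isotropic V-isotropic U+V-isotropic a b)
                                           (trans (*-congʳ γ≈0) (zeroˡ _)))
      by-γ (no γ≉0) = inj₂ (≡.subst (MeetsIn τ A L) (ℕ.+-comm 1 q) meets , isFqSubline)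
        where open RationalPoints I γ≉0

    classification : ∀ L → NonZero L →
      LineInΓ τ A L ⊎ MeetsIn τ A L 0 ⊎ MeetsIn τ A L 1 ⊎ MeetsIn τ A L 2
      ⊎ (MeetsIn τ A L (q ℕ.+ 1) × IsFqSubline q τ A L)
    classification L L≉0 = by-number-of-zeros (LineForm.projectiveZeros B)
      where
      B = lineBasis L L≉0
      by-number-of-zeros : ∃ (ProjectiveZeros (LineForm.form B)) →
        LineInΓ τ A L ⊎ MeetsIn τ A L 0 ⊎ MeetsIn τ A L 1 ⊎ MeetsIn τ A L 2
        ⊎ (MeetsIn τ A L (q ℕ.+ 1) × IsFqSubline q τ A L)
      by-number-of-zeros (0 , Z) = inj₂ (inj₁ (LineForm.meetsIn B Z))
      by-number-of-zeros (1 , Z) = inj₂ (inj₂ (inj₁ (LineForm.meetsIn B Z)))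
      by-number-of-zeros (2 , Z) = inj₂ (inj₂ (inj₂ (inj₁ (LineForm.meetsIn B Z))))
      by-number-of-zeros (suc (suc (suc t)) , Z) =
        map₂ (λ subline → inj₂ (inj₂ (inj₂ subline))) (isotropic-classification (isotropicBasis B Z))

open import Data.Nat using (_^_; _+_; _≥_)
open import Data.Product using (_×_)

mainTheorem2 : {c ℓ : Level} (F : CommutativeRing c ℓ) (q n m : ℕ) →
    let open FieldDefs F in IsPrimePower q → n ≥ 2 → IsField → HasSize (q ^ n) →
       gcd m n ≡ 1 → NonIdentity (σ q m) →
       (A : Mat3) (L : Vec3) → NonZero L →
       LineInΓ (σ q m) A L
       ⊎ MeetsIn (σ q m) A L 0
       ⊎ MeetsIn (σ q m) A L 1
       ⊎ MeetsIn (σ q m) A L 2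
       ⊎ (MeetsIn (σ q m) A L (q + 1) × IsFqSubline q (σ q m) A L)
mainTheorem2 F q (suc n) m q-primePower (s≤s _) isField size coprime _ A L L≉0 =
  classification q (σ-fixed⇒InFq coprime) InFq⇒σ-fixed subfieldEnumeration L L≉0
  where
  open Subfield F isField q n q-primePower size
  open FrobeniusPower m
  open Conic F isField size (FieldDefs.σ F q m) σ-isRingHomomorphism A
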